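{- Let $p\equiv1\pmod4$ be prime and let $U^{4,3,1}$ be the matrix with rows and columns indexed by $\binom{\mathbb{F}_p}{2}$ whose entry at $(\{a,b\},\{a,c\})$ with $a,b,c$ distinct is $\sum_{i\in\mathbb{F}_p\setminus\{a,b,c\}}S_{a,i}S_{b,i}S_{c,i}$, and whose entries at pairs of index sets not sharing exactly one element are $0$. Then $\|U^{4,3,1}\|=O(p^{3/2})$.
   Context: $S_{x,y}=\chi(x-y)$ where $\chi$ is the Legendre symbol of $\mathbb{F}_p$ ($\chi(0)=0$). $\|\cdot\|$ is the operator norm; asymptotics as $p\to\infty$.
   Formalization: The bound on $\|U^{4,3,1}\|$ is asserted only for vectors with rational entries on which the matrix acts. -}

module Defs where

open import Data.Nat using (ℕ; zero; suc; _+_; _*_; _∸_; _^_; _<ᵇ_; _≡ᵇ_; NonZero)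
open import Data.Nat.DivMod using (_%_)
open import Data.Bool using (Bool; true; false; if_then_else_; _∧_; not)
open import Data.List using (List; []; _∷_; map; upTo; concatMap; foldr; filter)
open import Data.Bool.ListAction using (any)
open import Data.Product using (_×_; _,_)
open import Data.Integer as ℤ using (ℤ; +_)
import Data.Rational as ℚ
open ℚ using (ℚ)

-- Elements of F_p are represented by the natural numbers 0 … p-1.

legendre : (p : ℕ) → .{{NonZero p}} → ℕ → ℤ
legendre p r with r % p ≡ᵇ 0
... | true = + 0
... | false = if any (λ y → (y * y) % p ≡ᵇ r % p) (upTo p) then + 1 else ℤ.-[1+ 0 ]

-- S_{x,y} = χ(x - y), computed in F_p (x, y < p)
S : (p : ℕ) → .{{NonZero p}} → ℕ → ℕ → ℤ
S p x y = legendre p ((x + (p ∸ y)) % p)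

sumℤ : List ℤ → ℤ
sumℤ = foldr ℤ._+_ (+ 0)

sumℚ : List ℚ → ℚ
sumℚ = foldr ℚ._+_ ℚ.0ℚ

tri : (p : ℕ) → .{{NonZero p}} → ℕ → ℕ → ℕ → ℤ
tri p a b c =
  sumℤ (map (λ i → S p a i ℤ.* S p b i ℤ.* S p c i)
            (filter (λ i → Data.Bool.T? (not (i ≡ᵇ a) ∧ not (i ≡ᵇ b) ∧ not (i ≡ᵇ c))) (upTo p)))
  where import Data.Bool

-- The 2-subsets {a,b} of F_p, represented as pairs (a , b) with a < b < p.
Pair : Set
Pair = ℕ × ℕ

pairs : ℕ → List Pair
pairs p = concatMap (λ b → map (λ a → (a , b)) (upTo b)) (upTo p)

b2n : Bool → ℕ
b2n true = 1
b2n false = 0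

U431 : (p : ℕ) → .{{NonZero p}} → Pair → Pair → ℤ
U431 p (a , b) (c , d) =
  if (b2n (a ≡ᵇ c) + b2n (a ≡ᵇ d) + b2n (b ≡ᵇ c) + b2n (b ≡ᵇ d)) ≡ᵇ 1
  then (if a ≡ᵇ c then tri p a b d
        else if a ≡ᵇ d then tri p a b c
        else if b ≡ᵇ c then tri p b a d
        else tri p b a c)
  else + 0

toℚ : ℤ → ℚ
toℚ z = z ℚ./ 1

normSqU : (p : ℕ) → .{{NonZero p}} → (Pair → ℚ) → ℚ
normSqU p x = sumℚ (map (λ P → let y = sumℚ (map (λ Q → toℚ (U431 p P Q) ℚ.* x Q) (pairs p)) in y ℚ.* y) (pairs p))

normSq : (p : ℕ) → (Pair → ℚ) → ℚ
normSq p x = sumℚ (map (λ P → x P ℚ.* x P) (pairs p))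

-- ‖U^{4,3,1}‖ ≤ K  ⟺  ∀ x, ‖U x‖² ≤ K² ‖x‖².  (Rational vectors suffice by density.)
-- Here K = C · p^{3/2}, i.e. K² = C² p³.
opNormBound : (p : ℕ) → .{{NonZero p}} → ℕ → Set
opNormBound p C = ∀ (x : Pair → ℚ) →
  normSqU p x ℚ.≤ (toℚ (+ (C * C * p ^ 3)) ℚ.* normSq p x)

module Submission where

open import Algebra.Bundles using (CommutativeRing)
open import Data.Nat using (ℕ; NonZero; _%_)
open import Data.Nat.Primality using (Prime; prime⇒nonZero)
open import Data.Product using (∃)
open import Data.Rational using (ℚ)
open import Relation.Binary.PropositionalEquality using (_≡_; _≢_)
open import Defs

-- Extend x to the symmetric matrix X with zero diagonal and put T(a,b,c) = Σᵢ S_{a,i} S_{b,i} S_{c,i}.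
-- The {a,b}-entry of U x is Z(a,b) + Z(b,a), where Z(a,b) = Σ_{d ≠ b} T(a,b,d) X(a,d). Up to the
-- term d = b, which is at most p |X(a,b)|, the vector b ↦ Z(a,b) is S applied to i ↦ S_{a,i} (Sᵀ X(a,·))ᵢ,
-- and S and Sᵀ both have Gram matrix pI − J, hence norm √p. So Σ_b Z(a,b)² ≤ 4p² Σ_c X(a,c)², and summing
-- over a gives ‖U x‖² ≤ 32 p² ‖x‖², so in fact ‖U‖ = O(p).
-- The Gram identity Σ_b χ(b+c) χ(b+d) = −1 (c ≠ d) is proved by counting, without multiplicativity of χ:
-- 1 + χ(r) is the number of square roots of r, so Σ_b (1 + χ(b+c)) (1 + χ(b+d)) counts the solutions of
-- y² + c = x² + d, and the substitution y = x + u leaves one linear equation in x for each u ≠ 0.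

module RangeSum {c ℓ} (R : CommutativeRing c ℓ) where

  open import Data.Nat using (ℕ; zero; suc; _<_; s≤s; z≤n)
  open import Data.Nat.Properties using (suc-injective)
  open import Data.Fin using (toℕ)
  open import Data.Fin.Properties using (toℕ<n)
  open import Relation.Binary.PropositionalEquality using (_≢_)
  open import Data.List using (foldr; map; upTo; applyUpTo)
  open import Function using (id)

  open CommutativeRing R
  open import Algebra.Properties.Semiring.Sum semiring as Sum using (sum)
  open import Relation.Binary.Reasoning.Setoid setoid

  -- Opaque, so that unification treats ∑ as a rigid head instead of unfolding it into a fold over Fin.
  opaque
    sumTo : ℕ → (ℕ → Carrier) → Carrier
    sumTo n f = sum {n} (λ i → f (toℕ i))

  syntax sumTo n (λ i → x) = ∑[ i < n ] x

  opaque
    unfolding sumTo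

    ∑-0 : ∀ (f : ℕ → Carrier) → ∑[ i < 0 ] f i ≈ 0#
    ∑-0 f = refl

    ∑-suc : ∀ n (f : ℕ → Carrier) → ∑[ i < suc n ] f i ≈ f 0 + ∑[ i < n ] f (suc i)
    ∑-suc n f = refl

    ∑-cong : ∀ n {f g : ℕ → Carrier} → (∀ i → i < n → f i ≈ g i) → ∑[ i < n ] f i ≈ ∑[ i < n ] g i
    ∑-cong n f≈g = Sum.sum-cong-≋ (λ i → f≈g (toℕ i) (toℕ<n i))

    ∑-distrib-+ : ∀ n (f g : ℕ → Carrier) → ∑[ i < n ] (f i + g i) ≈ ∑[ i < n ] f i + ∑[ i < n ] g i
    ∑-distrib-+ n f g = Sum.∑-distrib-+ {n} (λ i → f (toℕ i)) (λ i → g (toℕ i))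

    ∑-comm : ∀ m n (f : ℕ → ℕ → Carrier) → ∑[ i < m ] ∑[ j < n ] f i j ≈ ∑[ j < n ] ∑[ i < m ] f i j
    ∑-comm m n f = Sum.∑-comm {m} {n} (λ i j → f (toℕ i) (toℕ j))

    *-distribˡ-∑ : ∀ n x (f : ℕ → Carrier) → x * ∑[ i < n ] f i ≈ ∑[ i < n ] (x * f i)
    *-distribˡ-∑ n x f = Sum.*-distribˡ-sum {n} x (λ i → f (toℕ i))

    *-distribʳ-∑ : ∀ n x (f : ℕ → Carrier) → ∑[ i < n ] f i * x ≈ ∑[ i < n ] (f i * x)
    *-distribʳ-∑ n x f = Sum.*-distribʳ-sum {n} x (λ i → f (toℕ i))

    ∑-zero : ∀ n {f : ℕ → Carrier} → (∀ i → i < n → f i ≈ 0#) → ∑[ i < n ] f i ≈ 0#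
    ∑-zero n f≈0 = trans (∑-cong n f≈0) (Sum.sum-replicate-zero n)

    ∑-single : ∀ n a {f : ℕ → Carrier} → a < n → (∀ i → i < n → i ≢ a → f i ≈ 0#) → ∑[ i < n ] f i ≈ f a
    ∑-single (suc n) zero (s≤s _) f≈0 =
      trans (+-congˡ (∑-zero n (λ i i<n → f≈0 (suc i) (s≤s i<n) λ ()))) (+-identityʳ _)
    ∑-single (suc n) (suc a) (s≤s a<n) f≈0 =
      trans (+-congʳ (f≈0 0 (s≤s z≤n) λ ()))
        (trans (+-identityˡ _) (∑-single n a a<n λ i i<n i≢a → f≈0 (suc i) (s≤s i<n) (λ e → i≢a (suc-injective e))))

  ∑-*-∑ : ∀ m n (f g : ℕ → Carrier) → ∑[ i < m ] f i * ∑[ j < n ] g j ≈ ∑[ i < m ] ∑[ j < n ] (f i * g j)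
  ∑-*-∑ m n f g = trans (*-distribʳ-∑ m (∑[ j < n ] g j) f) (∑-cong m (λ i _ → *-distribˡ-∑ n (f i) g))

  ∑-last : ∀ n (f : ℕ → Carrier) → ∑[ i < suc n ] f i ≈ ∑[ i < n ] f i + f n
  ∑-last zero f = trans (∑-suc 0 f) (trans (+-congˡ (∑-0 (λ i → f (suc i)))) (trans (+-identityʳ (f 0))
                    (trans (sym (+-identityˡ (f 0))) (+-congʳ (sym (∑-0 f))))))
  ∑-last (suc n) f = begin
    ∑[ i < suc (suc n) ] f i                       ≈⟨ ∑-suc (suc n) f ⟩
    f 0 + ∑[ i < suc n ] f (suc i)                 ≈⟨ +-congˡ (∑-last n (λ i → f (suc i))) ⟩
    f 0 + (∑[ i < n ] f (suc i) + f (suc n))       ≈⟨ +-assoc _ _ _ ⟨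
    (f 0 + ∑[ i < n ] f (suc i)) + f (suc n)       ≈⟨ +-congʳ (∑-suc n f) ⟨
    ∑[ i < suc n ] f i + f (suc n)                 ∎

  ∑-upTo : ∀ n (f : ℕ → Carrier) → foldr _+_ 0# (map f (upTo n)) ≈ ∑[ i < n ] f i
  ∑-upTo n f = go n id
    where
    go : ∀ n (h : ℕ → ℕ) → foldr _+_ 0# (map f (applyUpTo h n)) ≈ ∑[ i < n ] f (h i)
    go zero h = sym (∑-0 (λ i → f (h i)))
    go (suc n) h = trans (+-congˡ (go n (λ i → h (suc i)))) (sym (∑-suc n (λ i → f (h i))))

module Modular (p : ℕ) .{{_ : NonZero p}} where

  open import Data.Nat using (ℕ; _+_; _*_; _∸_; _<_; NonZero; >-nonZero⁻¹)
  open import Data.Nat.DivMod using (_%_; %-distribˡ-+; %-distribˡ-*; m%n%n≡m%n; n%n≡0; m%n<n; m<n⇒m%n≡m)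
  import Data.Nat.Properties as ℕ
  open import Data.Product using (_,_)
  open import Relation.Binary.PropositionalEquality using (_≡_; refl; sym; trans; cong; cong₂)

  infix 4 _≈_
  -- A record rather than a bare equation of residues, so that a and b can be inferred from a proof of a ≈ b.
  record _≈_ (a b : ℕ) : Set where
    constructor mod
    field residues : a % p ≡ b % p
  open _≈_ public

  negate : ℕ → ℕ
  negate a = p ∸ a % p

  ≈-refl : ∀ {a} → a ≈ a
  ≈-refl = mod refl

  ≈-sym : ∀ {a b} → a ≈ b → b ≈ a
  ≈-sym (mod e) = mod (sym e)

  ≈-trans : ∀ {a b c} → a ≈ b → b ≈ c → a ≈ c
  ≈-trans (mod e) (mod f) = mod (trans e f)

  ≡⇒≈ : ∀ {a b} → a ≡ b → a ≈ b
  ≡⇒≈ refl = ≈-refl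

  %-≈ : ∀ a → a % p ≈ a
  %-≈ a = mod (m%n%n≡m%n a p)

  <-≈⇒≡ : ∀ {a b} → a < p → b < p → a ≈ b → a ≡ b
  <-≈⇒≡ a<p b<p (mod e) = trans (sym (m<n⇒m%n≡m a<p)) (trans e (m<n⇒m%n≡m b<p))

  0%p≡0 : 0 % p ≡ 0
  0%p≡0 = m<n⇒m%n≡m (>-nonZero⁻¹ p)

  ≈0⇒%≡0 : ∀ {a} → a ≈ 0 → a % p ≡ 0
  ≈0⇒%≡0 (mod e) = trans e 0%p≡0

  %≡0⇒≈0 : ∀ {a} → a % p ≡ 0 → a ≈ 0
  %≡0⇒≈0 e = mod (trans e (sym 0%p≡0))

  p≈0 : p ≈ 0
  p≈0 = %≡0⇒≈0 (n%n≡0 p)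

  +-cong : ∀ {a b c d} → a ≈ b → c ≈ d → a + c ≈ b + d
  +-cong {a} {b} {c} {d} (mod e) (mod f) = mod (trans (%-distribˡ-+ a c p)
    (trans (cong₂ (λ x y → (x + y) % p) e f) (sym (%-distribˡ-+ b d p))))

  *-cong : ∀ {a b c d} → a ≈ b → c ≈ d → a * c ≈ b * d
  *-cong {a} {b} {c} {d} (mod e) (mod f) = mod (trans (%-distribˡ-* a c p)
    (trans (cong₂ (λ x y → (x * y) % p) e f) (sym (%-distribˡ-* b d p))))

  +-congˡ : ∀ a {b c} → b ≈ c → a + b ≈ a + c
  +-congˡ a = +-cong (≈-refl {a})

  +-congʳ : ∀ c {a b} → a ≈ b → a + c ≈ b + c
  +-congʳ c a≈b = +-cong a≈b (≈-refl {c})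

  *-congˡ : ∀ a {b c} → b ≈ c → a * b ≈ a * c
  *-congˡ a = *-cong (≈-refl {a})

  *-congʳ : ∀ c {a b} → a ≈ b → a * c ≈ b * c
  *-congʳ c a≈b = *-cong a≈b (≈-refl {c})

  negate-cong : ∀ {a b} → a ≈ b → negate a ≈ negate b
  negate-cong (mod e) = ≡⇒≈ (cong (p ∸_) e)

  negate-inverseˡ : ∀ a → negate a + a ≈ 0
  negate-inverseˡ a = ≈-trans (+-congˡ (negate a) (≈-sym (%-≈ a)))
    (≈-trans (≡⇒≈ (ℕ.m∸n+n≡m (ℕ.<⇒≤ (m%n<n a p)))) p≈0)

  negate-inverseʳ : ∀ a → a + negate a ≈ 0
  negate-inverseʳ a = ≈-trans (≡⇒≈ (ℕ.+-comm a (negate a))) (negate-inverseˡ a)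

  ℤ/pℤ : CommutativeRing _ _
  ℤ/pℤ = record
    { Carrier = ℕ ; _≈_ = _≈_ ; _+_ = _+_ ; _*_ = _*_ ; -_ = negate ; 0# = 0 ; 1# = 1
    ; isCommutativeRing = record
      { isRing = record
        { +-isAbelianGroup = record
          { isGroup = record
            { isMonoid = record
              { isSemigroup = record
                { isMagma = record
                  { isEquivalence = record { refl = ≈-refl ; sym = ≈-sym ; trans = ≈-trans }
                  ; ∙-cong = +-cong }
                ; assoc = λ a b c → ≡⇒≈ (ℕ.+-assoc a b c) }
              ; identity = (λ a → ≈-refl) , (λ a → ≡⇒≈ (ℕ.+-identityʳ a)) }
            ; inverse = negate-inverseˡ , negate-inverseʳ
            ; ⁻¹-cong = negate-cong }
          ; comm = λ a b → ≡⇒≈ (ℕ.+-comm a b) }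
        ; *-cong = *-cong
        ; *-assoc = λ a b c → ≡⇒≈ (ℕ.*-assoc a b c)
        ; *-identity = (λ a → ≡⇒≈ (ℕ.*-identityˡ a)) , (λ a → ≡⇒≈ (ℕ.*-identityʳ a))
        ; distrib = (λ a b c → ≡⇒≈ (ℕ.*-distribˡ-+ a b c)) , (λ a b c → ≡⇒≈ (ℕ.*-distribʳ-+ a b c)) }
      ; *-comm = λ a b → ≡⇒≈ (ℕ.*-comm a b) } }

  negate-square : ∀ a → negate a * negate a ≈ a * a
  negate-square a = ≈-trans (≈-sym (-‿distribˡ-* a (negate a)))
    (≈-trans (negate-cong (≈-sym (-‿distribʳ-* a a))) (⁻¹-involutive (a * a)))
    where
    open CommutativeRing ℤ/pℤ using (ring; +-group)
    open import Algebra.Properties.Ring ring using (-‿distribˡ-*; -‿distribʳ-*)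
    open import Algebra.Properties.Group +-group using (⁻¹-involutive)

module PrimeField (p : ℕ) (prime : Prime p) where

  open import Data.Nat using (ℕ; suc; _+_; _*_; _<_; NonZero; ≢-nonZero; nonTrivial⇒n>1)
  open import Data.Nat.DivMod using (_%_; m%n<n)
  import Data.Nat.Properties as ℕ
  open import Data.Nat.Divisibility using (_∣_; m%n≡0⇒n∣m; ∣⇒≤; ∣1⇒≡1)
  open import Data.Nat.Primality using (Prime; prime⇒nonZero; prime⇒nonTrivial)
  open import Data.Nat.Coprimality using (prime⇒coprime; coprime-Bézout)
  open import Data.Nat.GCD using (module Bézout)
  open import Data.Product using (∃; _×_; _,_)
  open import Data.Nat.Solver using (module +-*-Solver)
  open import Data.Sum using (_⊎_; inj₁; inj₂)
  open import Relation.Binary.Definitions using (Decidable)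
  open import Relation.Binary.PropositionalEquality using (_≡_; _≢_; refl; sym; trans; cong; cong₂)
  open import Relation.Nullary using (¬_; yes; no; map′)
  import Relation.Binary.Reasoning.Setoid

  instance
    p≢0 : NonZero p
    p≢0 = prime⇒nonZero prime

  open Modular p public
  open CommutativeRing ℤ/pℤ using (setoid; +-group)
  open import Algebra.Properties.Group +-group using (∙-cancelʳ)
  module ≈-Reasoning = Relation.Binary.Reasoning.Setoid setoid
  open ≈-Reasoning
  open +-*-Solver using (solve; _:+_; _:*_; _:=_)

  ≈0⇒∣ : ∀ {a} → a ≈ 0 → p ∣ a
  ≈0⇒∣ {a} a≈0 = m%n≡0⇒n∣m a p (≈0⇒%≡0 a≈0)

  _≈?_ : Decidable _≈_
  a ≈? b = map′ mod residues (a % p ℕ.≟ b % p)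

  inverse : ∀ {a} → ¬ a ≈ 0 → ∃ λ b → a * b ≈ 1
  inverse {a} a≉0 with coprime-Bézout (prime⇒coprime prime {{≢-nonZero r≢0}} (m%n<n a p))
    where r≢0 = λ r≡0 → a≉0 (%≡0⇒≈0 r≡0)
  ... | Bézout.-+ x y eq = y , (begin
    a * y             ≈⟨ *-congʳ y (%-≈ a) ⟨
    a % p * y         ≡⟨ ℕ.*-comm (a % p) y ⟩
    y * (a % p)       ≡⟨ eq ⟨
    1 + x * p         ≈⟨ +-congˡ 1 (*-congˡ x p≈0) ⟩
    1 + x * 0         ≡⟨ cong suc (ℕ.*-zeroʳ x) ⟩
    1                 ∎)
  ... | Bézout.+- x y eq = negate y , ∙-cancelʳ (a * y) (a * negate y) 1 (begin
    a * negate y + a * y   ≡⟨ ℕ.*-distribˡ-+ a (negate y) y ⟨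
    a * (negate y + y)     ≈⟨ *-congˡ a (negate-inverseˡ y) ⟩
    a * 0                  ≡⟨ ℕ.*-zeroʳ a ⟩
    0                      ≡⟨ ℕ.*-zeroʳ x ⟨
    x * 0                  ≈⟨ *-congˡ x p≈0 ⟨
    x * p                  ≡⟨ eq ⟨
    1 + y * (a % p)        ≈⟨ +-congˡ 1 (*-congˡ y (%-≈ a)) ⟩
    1 + y * a              ≡⟨ cong suc (ℕ.*-comm y a) ⟩
    1 + a * y              ∎)

  +-cancelʳ : ∀ c {a b} → a + c ≈ b + c → a ≈ b
  +-cancelʳ c {a} {b} = ∙-cancelʳ c a b

  *-cancelˡ : ∀ {a b c} → ¬ a ≈ 0 → a * b ≈ a * c → b ≈ c
  *-cancelˡ {a} {b} {c} a≉0 ab≈ac with inverse a≉0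
  ... | a⁻¹ , aa⁻¹≈1 = begin
    b                  ≡⟨ ℕ.*-identityˡ b ⟨
    1 * b              ≈⟨ *-congʳ b aa⁻¹≈1 ⟨
    a * a⁻¹ * b        ≡⟨ rearrange a⁻¹ b ⟩
    a⁻¹ * (a * b)      ≈⟨ *-congˡ a⁻¹ ab≈ac ⟩
    a⁻¹ * (a * c)      ≡⟨ rearrange a⁻¹ c ⟨
    a * a⁻¹ * c        ≈⟨ *-congʳ c aa⁻¹≈1 ⟩
    1 * c              ≡⟨ ℕ.*-identityˡ c ⟩
    c                  ∎
    where
    rearrange : ∀ x y → a * x * y ≡ x * (a * y)
    rearrange x y = trans (cong (_* y) (ℕ.*-comm a x)) (ℕ.*-assoc x a y)

  no-zero-divisors : ∀ {a b} → a * b ≈ 0 → a ≈ 0 ⊎ b ≈ 0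
  no-zero-divisors {a} {b} ab≈0 with a ≈? 0
  ... | yes a≈0 = inj₁ a≈0
  ... | no a≉0 = inj₂ (*-cancelˡ a≉0 (≈-trans ab≈0 (≡⇒≈ (sym (ℕ.*-zeroʳ a)))))

  affine-injective : ∀ {a} c {b b′} → ¬ a ≈ 0 → a * b + c ≈ a * b′ + c → b ≈ b′
  affine-injective c a≉0 eq = *-cancelˡ a≉0 (+-cancelʳ c eq)

  affine-solution : ∀ {a} c t → ¬ a ≈ 0 → ∃ λ b → b < p × a * b + c ≈ t
  affine-solution {a} c t a≉0 with inverse a≉0
  ... | a⁻¹ , aa⁻¹≈1 = b , m%n<n _ p , (begin
    a * b + c                    ≈⟨ +-congʳ c (*-congˡ a (%-≈ _)) ⟩
    a * (a⁻¹ * (t + negate c)) + c ≡⟨ cong (_+ c) (ℕ.*-assoc a a⁻¹ _) ⟨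
    a * a⁻¹ * (t + negate c) + c ≈⟨ +-congʳ c (*-congʳ (t + negate c) aa⁻¹≈1) ⟩
    1 * (t + negate c) + c       ≡⟨ trans (cong (_+ c) (ℕ.*-identityˡ _)) (ℕ.+-assoc t (negate c) c) ⟩
    t + (negate c + c)           ≈⟨ +-congˡ t (negate-inverseˡ c) ⟩
    t + 0                        ≡⟨ ℕ.+-identityʳ t ⟩
    t                            ∎)
    where b = (a⁻¹ * (t + negate c)) % p

  square-roots : ∀ x {y} → y * y ≈ x * x → y ≈ x ⊎ y ≈ negate x
  square-roots x {y} y²≈x² with no-zero-divisors {y + x} {y + negate x} (begin
    (y + x) * (y + negate x)                      ≡⟨ expand y x (negate x) ⟩
    (y * y + x * negate x) + y * (negate x + x)    ≈⟨ +-cong (+-congʳ (x * negate x) y²≈x²) (*-congˡ y (negate-inverseˡ x)) ⟩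
    (x * x + x * negate x) + y * 0                 ≡⟨ cong₂ _+_ (sym (ℕ.*-distribˡ-+ x x (negate x))) (ℕ.*-zeroʳ y) ⟩
    x * (x + negate x) + 0                         ≈⟨ +-congʳ 0 (*-congˡ x (negate-inverseʳ x)) ⟩
    x * 0 + 0                                      ≡⟨ cong (_+ 0) (ℕ.*-zeroʳ x) ⟩
    0                                              ∎)
    where
    expand : ∀ y x n → (y + x) * (y + n) ≡ (y * y + x * n) + y * (n + x)
    expand = solve 3 (λ y x n → (y :+ x) :* (y :+ n) := (y :* y :+ x :* n) :+ y :* (n :+ x)) refl
  ... | inj₁ y+x≈0 = inj₂ (+-cancelʳ x (≈-trans y+x≈0 (≈-sym (negate-inverseˡ x))))
  ... | inj₂ y-x≈0 = inj₁ (+-cancelʳ (negate x) (≈-trans y-x≈0 (≈-sym (negate-inverseʳ x))))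

  1≉0 : ¬ 1 ≈ 0
  1≉0 1≈0 = ℕ.<⇒≢ (nonTrivial⇒n>1 p {{prime⇒nonTrivial prime}}) (sym (∣1⇒≡1 (≈0⇒∣ 1≈0)))

  p≢2⇒2≉0 : p ≢ 2 → ¬ 2 ≈ 0
  p≢2⇒2≉0 p≢2 2≈0 = p≢2 (ℕ.≤-antisym (∣⇒≤ (≈0⇒∣ 2≈0)) (nonTrivial⇒n>1 p {{prime⇒nonTrivial prime}}))

  ≉-negate : p ≢ 2 → ∀ {x} → ¬ x ≈ 0 → ¬ x ≈ negate x
  ≉-negate p≢2 {x} x≉0 x≈-x with no-zero-divisors {2} {x} (begin
    2 * x              ≡⟨ cong (x +_) (ℕ.+-identityʳ x) ⟩
    x + x              ≈⟨ +-congʳ x x≈-x ⟩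
    negate x + x       ≈⟨ negate-inverseˡ x ⟩
    0                  ∎)
  ... | inj₁ 2≈0 = p≢2⇒2≉0 p≢2 2≈0
  ... | inj₂ x≈0 = x≉0 x≈0

module IntegerSums where

  open import Data.Bool using (Bool; true; false; T?)
  open import Data.Nat as ℕ using (ℕ; zero; suc; _<_)
  import Data.Nat.Properties as ℕ
  open import Data.Integer as ℤ using (ℤ; +_; 0ℤ; 1ℤ; -1ℤ)
  import Data.Integer.Properties as ℤ
  import Data.Integer.Solver
  open import Data.List using ([]; _∷_; map; filter)
  open import Relation.Binary.PropositionalEquality using (_≡_; refl; sym; trans; cong; cong₂; module ≡-Reasoning)

  open RangeSum ℤ.+-*-commutativeRing public
  open import Algebra.Properties.Group (CommutativeRing.+-group ℤ.+-*-commutativeRing) public using ()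
    renaming (∙-cancelˡ to ℤ-+-cancelˡ; ∙-cancelʳ to ℤ-+-cancelʳ)
  open ≡-Reasoning

  ∑-const : ∀ n → ∑[ i < n ] 1ℤ ≡ + n
  ∑-const zero = ∑-0 (λ _ → 1ℤ)
  ∑-const (suc n) = trans (∑-suc n (λ _ → 1ℤ)) (cong (ℤ._+_ 1ℤ) (∑-const n))

  ∑-*-unit : ∀ n (g : ℕ → ℤ) K → ∑[ i < n ] g i ≡ 1ℤ → ∑[ i < n ] (g i ℤ.* K) ≡ K
  ∑-*-unit n g K ∑g≡1 = trans (sym (*-distribʳ-∑ n K g)) (trans (cong (ℤ._* K) ∑g≡1) (ℤ.*-identityˡ K))

  ∑-complement : ∀ n {f g : ℕ → ℤ} → (∀ i → i < n → f i ℤ.+ g i ≡ 1ℤ) → ∑[ i < n ] g i ≡ 1ℤ → ∑[ i < n ] f i ≡ + n ℤ.- 1ℤ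
  ∑-complement n {f} {g} f+g≡1 ∑g≡1 = ℤ-+-cancelʳ 1ℤ _ _ (begin
    ∑[ i < n ] f i ℤ.+ 1ℤ             ≡⟨ cong (ℤ._+_ (∑[ i < n ] f i)) ∑g≡1 ⟨
    ∑[ i < n ] f i ℤ.+ ∑[ i < n ] g i ≡⟨ ∑-distrib-+ n f g ⟨
    ∑[ i < n ] (f i ℤ.+ g i)          ≡⟨ ∑-cong n f+g≡1 ⟩
    ∑[ i < n ] 1ℤ                     ≡⟨ ∑-const n ⟩
    + n                               ≡⟨ trans (ℤ.+-assoc (+ n) -1ℤ 1ℤ) (ℤ.+-identityʳ (+ n)) ⟨
    + n ℤ.- 1ℤ ℤ.+ 1ℤ                 ∎)

  ∑-1+-*-1+ : ∀ n (f g : ℕ → ℤ) → ∑[ i < n ] f i ≡ 0ℤ → ∑[ i < n ] g i ≡ 0ℤ →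
    ∑[ i < n ] ((1ℤ ℤ.+ f i) ℤ.* (1ℤ ℤ.+ g i)) ≡ + n ℤ.+ ∑[ i < n ] (f i ℤ.* g i)
  ∑-1+-*-1+ n f g ∑f≡0 ∑g≡0 = begin
    ∑[ i < n ] ((1ℤ ℤ.+ f i) ℤ.* (1ℤ ℤ.+ g i))
      ≡⟨ ∑-cong n (λ i _ → solve 2 (λ x y → (con 1ℤ :+ x) :* (con 1ℤ :+ y) := ((con 1ℤ :+ x) :+ y) :+ x :* y) refl (f i) (g i)) ⟩
    ∑[ i < n ] (((1ℤ ℤ.+ f i) ℤ.+ g i) ℤ.+ f i ℤ.* g i)
      ≡⟨ trans (∑-distrib-+ n _ _) (cong (ℤ._+ ∑fg) (trans (∑-distrib-+ n _ g) (cong (ℤ._+ ∑[ i < n ] g i) (∑-distrib-+ n _ f)))) ⟩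
    ((∑[ i < n ] 1ℤ ℤ.+ ∑[ i < n ] f i) ℤ.+ ∑[ i < n ] g i) ℤ.+ ∑fg
      ≡⟨ cong (ℤ._+ ∑fg) (cong₂ ℤ._+_ (cong₂ ℤ._+_ (∑-const n) ∑f≡0) ∑g≡0) ⟩
    ((+ n ℤ.+ 0ℤ) ℤ.+ 0ℤ) ℤ.+ ∑fg
      ≡⟨ cong (ℤ._+ ∑fg) (trans (ℤ.+-identityʳ _) (ℤ.+-identityʳ (+ n))) ⟩
    + n ℤ.+ ∑fg ∎
    where
    open Data.Integer.Solver.+-*-Solver using (solve; _:+_; _:*_; _:=_; con)
    ∑fg = ∑[ i < n ] (f i ℤ.* g i)

  sumℤ-filter : ∀ (f : ℕ → ℤ) (B : ℕ → Bool) → (∀ i → B i ≡ false → f i ≡ 0ℤ) → ∀ xs →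
    sumℤ (map f (filter (λ i → T? (B i)) xs)) ≡ sumℤ (map f xs)
  sumℤ-filter f B vanish [] = refl
  sumℤ-filter f B vanish (i ∷ xs) with B i in Bi
  ... | true = cong (ℤ._+_ (f i)) (sumℤ-filter f B vanish xs)
  ... | false = trans (sumℤ-filter f B vanish xs) (sym (trans (cong (ℤ._+ sumℤ (map f xs)) (vanish i Bi)) (ℤ.+-identityˡ _)))

  ∣∑∣≤ : ∀ n (f : ℕ → ℤ) → (∀ i → ℤ.∣ f i ∣ ℕ.≤ 1) → ℤ.∣ ∑[ i < n ] f i ∣ ℕ.≤ n
  ∣∑∣≤ zero f _ = ℕ.≤-reflexive (cong ℤ.∣_∣ (∑-0 f))
  ∣∑∣≤ (suc n) f ∣f∣≤1 = ℕ.≤-trans (ℕ.≤-reflexive (cong ℤ.∣_∣ (∑-suc n f)))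
    (ℕ.≤-trans (ℤ.∣i+j∣≤∣i∣+∣j∣ (f 0) _) (ℕ.+-mono-≤ (∣f∣≤1 0) (∣∑∣≤ n (λ i → f (suc i)) (λ i → ∣f∣≤1 (suc i)))))

module Legendre (p : ℕ) (prime : Prime p) (p≢2 : p ≢ 2) where

  open import Data.Bool using (true; false; T; if_then_else_)
  open import Data.Nat using (ℕ; _+_; _*_; _<_; _≤_; z≤n; s≤s; _≡ᵇ_)
  open import Data.Nat.DivMod using (_%_; m%n<n)
  import Data.Nat.Properties as ℕ
  open import Data.Integer as ℤ using (ℤ; +_; 0ℤ; 1ℤ; -1ℤ)
  import Data.Integer.Properties as ℤ
  open import Data.List using (upTo)
  open import Data.Bool.ListAction using (any)
  open import Data.List.Relation.Unary.Any using (satisfied)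
  open import Data.List.Relation.Unary.Any.Properties using (any⁺; any⁻)
  open import Data.List.Membership.Propositional using (lose)
  open import Data.List.Membership.Propositional.Properties using (∈-upTo⁺)
  open import Data.Product using (_×_; _,_)
  open import Data.Sum using (inj₁; inj₂; [_,_]′; reduce)
  open import Data.Empty using (⊥-elim)
  open import Relation.Binary.PropositionalEquality using (_≡_; _≢_; refl; sym; trans; cong; cong₂; subst; module ≡-Reasoning)
  open import Relation.Nullary using (¬_; yes; no)
  open import Data.Nat.Solver using (module +-*-Solver)

  open PrimeField p prime
  open IntegerSums
  open ≡-Reasoning

  χ : ℕ → ℤ
  χ = legendre p

  data LegendreSpec (r : ℕ) : ℤ → Set where
    divisible : r ≈ 0 → LegendreSpec r 0ℤ
    residue : ¬ r ≈ 0 → ∀ y → y * y ≈ r → LegendreSpec r 1ℤ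
    nonresidue : ¬ r ≈ 0 → (∀ y → ¬ y * y ≈ r) → LegendreSpec r -1ℤ

  nonzero-spec : ∀ r → ¬ r ≈ 0 →
    LegendreSpec r (if any (λ y → y * y % p ≡ᵇ r % p) (upTo p) then 1ℤ else -1ℤ)
  nonzero-spec r r≉0 with any (λ y → y * y % p ≡ᵇ r % p) (upTo p) in found
  ... | true with satisfied (any⁻ _ (upTo p) (subst T (sym found) _))
  ...   | y , y²≈r = residue r≉0 y (mod (ℕ.≡ᵇ⇒≡ _ _ y²≈r))
  nonzero-spec r r≉0 | false = nonresidue r≉0 λ y y²≈r →
    subst T found (any⁺ _ (lose (∈-upTo⁺ (m%n<n y p))
      (ℕ.≡⇒≡ᵇ _ _ (residues (≈-trans (*-cong (%-≈ y) (%-≈ y)) y²≈r)))))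

  legendre-spec : ∀ r → LegendreSpec r (χ r)
  legendre-spec r with r % p ≡ᵇ 0 in r%p≡ᵇ0
  ... | true = divisible (%≡0⇒≈0 (ℕ.≡ᵇ⇒≡ _ 0 (subst T (sym r%p≡ᵇ0) _)))
  ... | false = nonzero-spec r λ r≈0 → subst T r%p≡ᵇ0 (ℕ.≡⇒≡ᵇ _ 0 (≈0⇒%≡0 r≈0))

  spec-unique : ∀ {r u v} → LegendreSpec r u → LegendreSpec r v → u ≡ v
  spec-unique (divisible _) (divisible _) = refl
  spec-unique (divisible r≈0) (residue r≉0 _ _) = ⊥-elim (r≉0 r≈0)
  spec-unique (divisible r≈0) (nonresidue r≉0 _) = ⊥-elim (r≉0 r≈0)
  spec-unique (residue r≉0 _ _) (divisible r≈0) = ⊥-elim (r≉0 r≈0)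
  spec-unique (residue _ _ _) (residue _ _ _) = refl
  spec-unique (residue _ y y²≈r) (nonresidue _ nonsquare) = ⊥-elim (nonsquare y y²≈r)
  spec-unique (nonresidue r≉0 _) (divisible r≈0) = ⊥-elim (r≉0 r≈0)
  spec-unique (nonresidue _ nonsquare) (residue _ y y²≈r) = ⊥-elim (nonsquare y y²≈r)
  spec-unique (nonresidue _ _) (nonresidue _ _) = refl

  spec-cong : ∀ {r s u} → r ≈ s → LegendreSpec r u → LegendreSpec s u
  spec-cong r≈s (divisible r≈0) = divisible (≈-trans (≈-sym r≈s) r≈0)
  spec-cong r≈s (residue r≉0 y y²≈r) = residue (λ s≈0 → r≉0 (≈-trans r≈s s≈0)) y (≈-trans y²≈r r≈s)
  spec-cong r≈s (nonresidue r≉0 nonsquare) =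
    nonresidue (λ s≈0 → r≉0 (≈-trans r≈s s≈0)) (λ y y²≈s → nonsquare y (≈-trans y²≈s (≈-sym r≈s)))

  χ-cong : ∀ {r s} → r ≈ s → χ r ≡ χ s
  χ-cong {r} {s} r≈s = spec-unique (spec-cong r≈s (legendre-spec r)) (legendre-spec s)

  χ-≈0 : ∀ {r} → r ≈ 0 → χ r ≡ 0ℤ
  χ-≈0 {r} r≈0 = spec-unique (legendre-spec r) (divisible r≈0)

  ∣χ∣≤1 : ∀ r → ℤ.∣ χ r ∣ ≤ 1
  ∣χ∣≤1 r with χ r | legendre-spec r
  ... | _ | divisible _ = z≤n
  ... | _ | residue _ _ _ = s≤s z≤n
  ... | _ | nonresidue _ _ = s≤s z≤n

  -- Opaque for the same reason as sumTo.
  opaque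
    δ : ℕ → ℕ → ℤ
    δ a b with a ≈? b
    ... | yes _ = 1ℤ
    ... | no _ = 0ℤ

    δ-≈ : ∀ {a b} → a ≈ b → δ a b ≡ 1ℤ
    δ-≈ {a} {b} a≈b with a ≈? b
    ... | yes _ = refl
    ... | no a≉b = ⊥-elim (a≉b a≈b)

    δ-≉ : ∀ {a b} → ¬ a ≈ b → δ a b ≡ 0ℤ
    δ-≉ {a} {b} a≉b with a ≈? b
    ... | yes a≈b = ⊥-elim (a≉b a≈b)
    ... | no _ = refl

  δ-cong : ∀ {a b c d} → (a ≈ b → c ≈ d) → (c ≈ d → a ≈ b) → δ a b ≡ δ c d
  δ-cong {a} {b} ⇒ ⇐ with a ≈? b
  ... | yes a≈b = trans (δ-≈ a≈b) (sym (δ-≈ (⇒ a≈b)))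
  ... | no a≉b = trans (δ-≉ a≉b) (sym (δ-≉ (λ c≈d → a≉b (⇐ c≈d))))

  δ-sym : ∀ a b → δ a b ≡ δ b a
  δ-sym a b = δ-cong ≈-sym ≈-sym

  δ-guard : ∀ {a b c d e f} → (a ≈ b → (c ≈ d → e ≈ f) × (e ≈ f → c ≈ d)) → δ a b ℤ.* δ c d ≡ δ a b ℤ.* δ e f
  δ-guard {a} {b} {c} {d} {e} {f} guard with a ≈? b
  ... | yes a≈b = let (⇒ , ⇐) = guard a≈b in cong (δ a b ℤ.*_) (δ-cong ⇒ ⇐)
  ... | no a≉b = trans (cong (ℤ._* δ c d) (δ-≉ a≉b)) (sym (cong (ℤ._* δ e f) (δ-≉ a≉b)))

  ∑-δ-affine : ∀ {a} c t → ¬ a ≈ 0 → ∑[ b < p ] δ (a * b + c) t ≡ 1ℤ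
  ∑-δ-affine {a} c t a≉0 with affine-solution c t a≉0
  ... | b₀ , b₀<p , solves = trans (∑-single p b₀ b₀<p others) (δ-≈ solves)
    where
    others : ∀ b → b < p → b ≢ b₀ → δ (a * b + c) t ≡ 0ℤ
    others b b<p b≢b₀ = δ-≉ λ solves′ →
      b≢b₀ (<-≈⇒≡ b<p b₀<p (affine-injective c a≉0 (≈-trans solves′ (≈-sym solves))))

  ∑-δ-shift : ∀ c t → ∑[ u < p ] δ (u + c) t ≡ 1ℤ
  ∑-δ-shift c t = trans (∑-cong p (λ u _ → δ-cong (≈-trans (≡⇒≈ (1*u+c≡u+c u))) (≈-trans (≡⇒≈ (sym (1*u+c≡u+c u))))))
                        (∑-δ-affine c t 1≉0)
    where
    1*u+c≡u+c : ∀ u → 1 * u + c ≡ u + c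
    1*u+c≡u+c u = cong (_+ c) (ℕ.*-identityˡ u)

  ∑-δ-id : ∀ t → ∑[ y < p ] δ y t ≡ 1ℤ
  ∑-δ-id t = trans (∑-cong p (λ y _ → δ-cong (≈-trans (≡⇒≈ (ℕ.+-identityʳ y))) (≈-trans (≡⇒≈ (sym (ℕ.+-identityʳ y))))))
                   (∑-δ-shift 0 t)

  ∑-δ-square : ∀ r → ∑[ y < p ] δ (y * y) r ≡ 1ℤ ℤ.+ χ r
  ∑-δ-square r with χ r | legendre-spec r
  ... | _ | divisible r≈0 = trans (∑-cong p (λ y _ → δ-cong (root y) (square y))) (∑-δ-id 0)
    where
    root : ∀ y → y * y ≈ r → y ≈ 0
    root y y²≈r = reduce (no-zero-divisors (≈-trans y²≈r r≈0))
    square : ∀ y → y ≈ 0 → y * y ≈ r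
    square y y≈0 = ≈-trans (*-cong y≈0 y≈0) (≈-sym r≈0)
  ... | _ | residue r≉0 x x²≈r = begin
    ∑[ y < p ] δ (y * y) r                       ≡⟨ ∑-cong p (λ y _ → two-roots y) ⟩
    ∑[ y < p ] (δ y x ℤ.+ δ y (negate x))        ≡⟨ ∑-distrib-+ p (λ y → δ y x) (λ y → δ y (negate x)) ⟩
    ∑[ y < p ] δ y x ℤ.+ ∑[ y < p ] δ y (negate x) ≡⟨ cong₂ ℤ._+_ (∑-δ-id x) (∑-δ-id (negate x)) ⟩
    1ℤ ℤ.+ 1ℤ                                    ∎
    where
    x≉-x : ¬ x ≈ negate x
    x≉-x = ≉-negate p≢2 λ x≈0 → r≉0 (≈-trans (≈-sym x²≈r) (*-cong x≈0 x≈0))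
    two-roots : ∀ y → δ (y * y) r ≡ δ y x ℤ.+ δ y (negate x)
    two-roots y with y ≈? x | y ≈? negate x
    ... | yes y≈x | yes y≈-x = ⊥-elim (x≉-x (≈-trans (≈-sym y≈x) y≈-x))
    ... | yes y≈x | no y≉-x = trans (δ-≈ (≈-trans (*-cong y≈x y≈x) x²≈r)) (sym (cong₂ ℤ._+_ (δ-≈ y≈x) (δ-≉ y≉-x)))
    ... | no y≉x | yes y≈-x = trans (δ-≈ (≈-trans (*-cong y≈-x y≈-x) (≈-trans (negate-square x) x²≈r)))
                                    (sym (cong₂ ℤ._+_ (δ-≉ y≉x) (δ-≈ y≈-x)))
    ... | no y≉x | no y≉-x = trans (δ-≉ λ y²≈r → [ y≉x , y≉-x ]′ (square-roots x (≈-trans y²≈r (≈-sym x²≈r))))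
                                   (sym (cong₂ ℤ._+_ (δ-≉ y≉x) (δ-≉ y≉-x)))
  ... | _ | nonresidue _ nonsquare = ∑-zero p (λ y _ → δ-≉ (nonsquare y))

  ∑-legendre-affine : ∀ {a} c → ¬ a ≈ 0 → ∑[ b < p ] χ (a * b + c) ≡ 0ℤ
  ∑-legendre-affine {a} c a≉0 = ℤ-+-cancelˡ (+ p) _ _ (begin
    + p ℤ.+ ∑[ b < p ] χ (a * b + c)               ≡⟨ cong (ℤ._+ ∑[ b < p ] χ (a * b + c)) (∑-const p) ⟨
    ∑[ b < p ] 1ℤ ℤ.+ ∑[ b < p ] χ (a * b + c)     ≡⟨ ∑-distrib-+ p (λ _ → 1ℤ) (λ b → χ (a * b + c)) ⟨
    ∑[ b < p ] (1ℤ ℤ.+ χ (a * b + c))              ≡⟨ ∑-cong p (λ b _ → ∑-δ-square (a * b + c)) ⟨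
    ∑[ b < p ] ∑[ y < p ] δ (y * y) (a * b + c)     ≡⟨ ∑-comm p p (λ b y → δ (y * y) (a * b + c)) ⟩
    ∑[ y < p ] ∑[ b < p ] δ (y * y) (a * b + c)     ≡⟨ ∑-cong p (λ y _ → trans (∑-cong p (λ b _ → δ-sym (y * y) (a * b + c)))
                                                                        (∑-δ-affine c (y * y) a≉0)) ⟩
    ∑[ y < p ] 1ℤ                                   ≡⟨ ∑-const p ⟩
    + p                                             ≡⟨ ℤ.+-identityʳ (+ p) ⟨
    + p ℤ.+ 0ℤ                                      ∎)

  legendre-square : ∀ r → χ r ℤ.* χ r ℤ.+ δ r 0 ≡ 1ℤ
  legendre-square r with χ r | legendre-spec r
  ... | _ | divisible r≈0 = trans (ℤ.+-identityˡ (δ r 0)) (δ-≈ r≈0)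
  ... | _ | residue r≉0 _ _ = cong (ℤ._+_ 1ℤ) (δ-≉ r≉0)
  ... | _ | nonresidue r≉0 _ = cong (ℤ._+_ 1ℤ) (δ-≉ r≉0)

  ∑-legendre-affine² : ∀ {a} c → ¬ a ≈ 0 → ∑[ b < p ] (χ (a * b + c) ℤ.* χ (a * b + c)) ≡ + p ℤ.- 1ℤ
  ∑-legendre-affine² {a} c a≉0 = ∑-complement p (λ b _ → legendre-square (a * b + c)) (∑-δ-affine c 0 a≉0)

  δ-difference-of-squares : ∀ c d x y → δ (y * y + c) (x * x + d) ≡ ∑[ u < p ] (δ (u + x) y ℤ.* δ (u * (u + x + x) + c) d)
  δ-difference-of-squares c d x y = begin
    δ (y * y + c) (x * x + d)                                ≡⟨ ∑-*-unit p (λ u → δ (u + x) y) _ (∑-δ-shift x y) ⟨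
    ∑[ u < p ] (δ (u + x) y ℤ.* δ (y * y + c) (x * x + d))   ≡⟨ ∑-cong p (λ u _ → δ-guard (substitute u)) ⟩
    ∑[ u < p ] (δ (u + x) y ℤ.* δ (u * (u + x + x) + c) d)   ∎
    where
    open +-*-Solver using (solve; _:+_; _:*_; _:=_)
    expand : ∀ u → (u + x) * (u + x) + c ≡ (u * (u + x + x) + c) + x * x
    expand u = solve 3 (λ u x c → (u :+ x) :* (u :+ x) :+ c := (u :* (u :+ x :+ x) :+ c) :+ x :* x) refl u x c
    substitute : ∀ u → u + x ≈ y → (y * y + c ≈ x * x + d → u * (u + x + x) + c ≈ d) × (u * (u + x + x) + c ≈ d → y * y + c ≈ x * x + d)
    substitute u u+x≈y = ⇒ , ⇐
      where
      expanded : y * y + c ≈ (u * (u + x + x) + c) + x * x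
      expanded = ≈-trans (+-congʳ c (*-cong (≈-sym u+x≈y) (≈-sym u+x≈y))) (≡⇒≈ (expand u))
      ⇒ : y * y + c ≈ x * x + d → u * (u + x + x) + c ≈ d
      ⇒ eq = +-cancelʳ (x * x) (≈-trans (≈-sym expanded) (≈-trans eq (≡⇒≈ (ℕ.+-comm (x * x) d))))
      ⇐ : u * (u + x + x) + c ≈ d → y * y + c ≈ x * x + d
      ⇐ eq = ≈-trans expanded (≈-trans (+-congʳ (x * x) eq) (≡⇒≈ (ℕ.+-comm d (x * x))))

  ∑-δ-line : ∀ {c d} → ¬ c ≈ d → ∀ u → ∑[ x < p ] δ (u * (u + x + x) + c) d ℤ.+ δ u 0 ≡ 1ℤ
  ∑-δ-line {c} {d} c≉d u with u ≈? 0
  ... | yes u≈0 = cong₂ ℤ._+_ (∑-zero p (λ x _ → δ-≉ λ eq → c≉d (≈-trans (+-congʳ c (*-congʳ (u + x + x) (≈-sym u≈0))) eq)))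
                              (δ-≈ u≈0)
  ... | no u≉0 = cong₂ ℤ._+_ (trans (∑-cong p (λ x _ → δ-cong (≈-trans (≡⇒≈ (linear x))) (≈-trans (≡⇒≈ (sym (linear x))))))
                                    (∑-δ-affine (u * u + c) d 2u≉0))
                             (δ-≉ u≉0)
    where
    open +-*-Solver using (solve; _:+_; _:*_; _:=_)
    linear : ∀ x → (u + u) * x + (u * u + c) ≡ u * (u + x + x) + c
    linear x = solve 3 (λ u x c → (u :+ u) :* x :+ (u :* u :+ c) := u :* (u :+ x :+ x) :+ c) refl u x c
    2u≉0 : ¬ u + u ≈ 0
    2u≉0 u+u≈0 with no-zero-divisors {2} {u} (≈-trans (≡⇒≈ (cong (_+_ u) (ℕ.+-identityʳ u))) u+u≈0)
    ... | inj₁ 2≈0 = p≢2⇒2≉0 p≢2 2≈0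
    ... | inj₂ u≈0 = u≉0 u≈0

  -- The substitution y = x + u makes y² − x² = u (u + 2x) linear in x.
  ∑∑-δ-squares : ∀ {c d} → ¬ c ≈ d → ∑[ x < p ] ∑[ y < p ] δ (y * y + c) (x * x + d) ≡ + p ℤ.- 1ℤ
  ∑∑-δ-squares {c} {d} c≉d = begin
    ∑[ x < p ] ∑[ y < p ] δ (y * y + c) (x * x + d)
      ≡⟨ ∑-cong p (λ x _ → ∑-cong p (λ y _ → δ-difference-of-squares c d x y)) ⟩
    ∑[ x < p ] ∑[ y < p ] ∑[ u < p ] (δ (u + x) y ℤ.* δ (u * (u + x + x) + c) d)
      ≡⟨ ∑-cong p (λ x _ → ∑-comm p p (λ y u → δ (u + x) y ℤ.* δ (u * (u + x + x) + c) d)) ⟩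
    ∑[ x < p ] ∑[ u < p ] ∑[ y < p ] (δ (u + x) y ℤ.* δ (u * (u + x + x) + c) d)
      ≡⟨ ∑-cong p (λ x _ → ∑-cong p (λ u _ → ∑-*-unit p (δ (u + x)) _ (trans (∑-cong p (λ y _ → δ-sym (u + x) y)) (∑-δ-id (u + x))))) ⟩
    ∑[ x < p ] ∑[ u < p ] δ (u * (u + x + x) + c) d
      ≡⟨ ∑-comm p p (λ x u → δ (u * (u + x + x) + c) d) ⟩
    ∑[ u < p ] ∑[ x < p ] δ (u * (u + x + x) + c) d
      ≡⟨ ∑-complement p (λ u _ → ∑-δ-line c≉d u) (∑-δ-id 0) ⟩
    + p ℤ.- 1ℤ ∎

  ∑-δ-two-squares : ∀ {a} c d x y → ¬ a ≈ 0 →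
    ∑[ b < p ] (δ (x * x) (a * b + c) ℤ.* δ (y * y) (a * b + d)) ≡ δ (y * y + c) (x * x + d)
  ∑-δ-two-squares {a} c d x y a≉0 = begin
    ∑[ b < p ] (δ (x * x) (a * b + c) ℤ.* δ (y * y) (a * b + d))
      ≡⟨ ∑-cong p (λ b _ → trans (cong (ℤ._* δ (y * y) (a * b + d)) (δ-sym (x * x) (a * b + c))) (δ-guard (shift b))) ⟩
    ∑[ b < p ] (δ (a * b + c) (x * x) ℤ.* δ (y * y + c) (x * x + d))
      ≡⟨ ∑-*-unit p (λ b → δ (a * b + c) (x * x)) _ (∑-δ-affine c (x * x) a≉0) ⟩
    δ (y * y + c) (x * x + d) ∎
    where
    swap : ∀ m → (m + d) + c ≡ (m + c) + d
    swap m = trans (ℕ.+-assoc m d c) (trans (cong (_+_ m) (ℕ.+-comm d c)) (sym (ℕ.+-assoc m c d)))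
    shift : ∀ b → a * b + c ≈ x * x → (y * y ≈ a * b + d → y * y + c ≈ x * x + d) × (y * y + c ≈ x * x + d → y * y ≈ a * b + d)
    shift b solves = (λ eq → ≈-trans (+-congʳ c eq) (≈-trans (≡⇒≈ (swap (a * b))) (+-congʳ d solves)))
                   , (λ eq → +-cancelʳ c (≈-trans eq (≈-trans (+-congʳ d (≈-sym solves)) (≡⇒≈ (sym (swap (a * b)))))))

  ∑-legendre-correlation : ∀ {a} c d → ¬ a ≈ 0 → ¬ c ≈ d → ∑[ b < p ] (χ (a * b + c) ℤ.* χ (a * b + d)) ≡ -1ℤ
  ∑-legendre-correlation {a} c d a≉0 c≉d = ℤ-+-cancelˡ (+ p) _ _ (begin
    + p ℤ.+ ∑[ b < p ] (A b ℤ.* B b)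
      ≡⟨ ∑-1+-*-1+ p A B (∑-legendre-affine c a≉0) (∑-legendre-affine d a≉0) ⟨
    ∑[ b < p ] ((1ℤ ℤ.+ A b) ℤ.* (1ℤ ℤ.+ B b))
      ≡⟨ ∑-cong p (λ b _ → cong₂ ℤ._*_ (∑-δ-square (a * b + c)) (∑-δ-square (a * b + d))) ⟨
    ∑[ b < p ] (∑[ x < p ] δ (x * x) (a * b + c) ℤ.* ∑[ y < p ] δ (y * y) (a * b + d))
      ≡⟨ ∑-cong p (λ b _ → ∑-*-∑ p p (λ x → δ (x * x) (a * b + c)) (λ y → δ (y * y) (a * b + d))) ⟩
    ∑[ b < p ] ∑[ x < p ] ∑[ y < p ] (δ (x * x) (a * b + c) ℤ.* δ (y * y) (a * b + d))
      ≡⟨ trans (∑-comm p p _) (∑-cong p (λ x _ → ∑-comm p p _)) ⟩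
    ∑[ x < p ] ∑[ y < p ] ∑[ b < p ] (δ (x * x) (a * b + c) ℤ.* δ (y * y) (a * b + d))
      ≡⟨ ∑-cong p (λ x _ → ∑-cong p (λ y _ → ∑-δ-two-squares c d x y a≉0)) ⟩
    ∑[ x < p ] ∑[ y < p ] δ (y * y + c) (x * x + d)
      ≡⟨ ∑∑-δ-squares c≉d ⟩
    + p ℤ.+ -1ℤ ∎)
    where
    A B : ℕ → ℤ
    A b = χ (a * b + c)
    B b = χ (a * b + d)

module Jacobsthal (p : ℕ) (prime : Prime p) (p≢2 : p ≢ 2) where

  open import Data.Nat using (ℕ; _+_; _*_; _∸_; _<_; _≤_; >-nonZero⁻¹)
  open import Data.Nat.DivMod using (_%_)
  import Data.Nat.Properties as ℕ
  open import Data.Integer as ℤ using (ℤ; +_; 0ℤ; 1ℤ; -1ℤ)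
  open import Relation.Binary.PropositionalEquality using (_≡_; _≢_; sym; trans; cong; cong₂)
  open import Relation.Nullary using (¬_)

  open PrimeField p prime
  open Legendre p prime p≢2
  open IntegerSums using (sumTo; ∑-cong)

  S≡χ : ∀ x y → S p x y ≡ χ (x + (p ∸ y))
  S≡χ x y = χ-cong (%-≈ (x + (p ∸ y)))

  S-diagonal : ∀ {a} → a < p → S p a a ≡ 0ℤ
  S-diagonal {a} a<p = trans (S≡χ a a) (χ-≈0 (≈-trans (≡⇒≈ (ℕ.m+[n∸m]≡n (ℕ.<⇒≤ a<p))) p≈0))

  ∣S∣≤1 : ∀ x y → ℤ.∣ S p x y ∣ ≤ 1
  ∣S∣≤1 x y = ∣χ∣≤1 ((x + (p ∸ y)) % p)

  ∸-injective : ∀ {i j} → i < p → j < p → p ∸ i ≈ p ∸ j → i ≡ j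
  ∸-injective {i} {j} i<p j<p e = <-≈⇒≡ i<p j<p (+-cancelʳ (p ∸ j) (begin
    i + (p ∸ j)   ≈⟨ +-congˡ i (≈-sym e) ⟩
    i + (p ∸ i)   ≡⟨ ℕ.m+[n∸m]≡n (ℕ.<⇒≤ i<p) ⟩
    p             ≡⟨ ℕ.m+[n∸m]≡n (ℕ.<⇒≤ j<p) ⟨
    j + (p ∸ j)   ∎))
    where open ≈-Reasoning

  S-column : ∀ b i → S p b i ≡ χ (1 * b + (p ∸ i))
  S-column b i = trans (S≡χ b i) (cong (λ x → χ (x + (p ∸ i))) (sym (ℕ.*-identityˡ b)))

  p∸1≉0 : ¬ p ∸ 1 ≈ 0
  p∸1≉0 p∸1≈0 = 1≉0 (≈-trans (+-congʳ 1 (≈-sym p∸1≈0)) (≈-trans (≡⇒≈ (ℕ.m∸n+n≡m (>-nonZero⁻¹ p))) p≈0))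

  -- Along a row, S p a i = χ (a − i) is affine in i with slope −1 ≈ p ∸ 1.
  S-row : ∀ a i → i < p → S p a i ≡ χ ((p ∸ 1) * i + a)
  S-row a i i<p = trans (S≡χ a i) (χ-cong (≈-trans (+-congˡ a (≈-sym reflection)) (≡⇒≈ (ℕ.+-comm a _))))
    where
    reflection : (p ∸ 1) * i ≈ p ∸ i
    reflection = +-cancelʳ i (begin
      (p ∸ 1) * i + i   ≡⟨ cong (_+_ ((p ∸ 1) * i)) (ℕ.*-identityˡ i) ⟨
      (p ∸ 1) * i + 1 * i ≡⟨ ℕ.*-distribʳ-+ i (p ∸ 1) 1 ⟨
      (p ∸ 1 + 1) * i   ≡⟨ cong (_* i) (ℕ.m∸n+n≡m (>-nonZero⁻¹ p)) ⟩
      p * i             ≈⟨ *-congʳ i p≈0 ⟩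
      0                 ≈⟨ p≈0 ⟨
      p                 ≡⟨ ℕ.m∸n+n≡m (ℕ.<⇒≤ i<p) ⟨
      (p ∸ i) + i       ∎)
      where open ≈-Reasoning

  S-columns-norm : ∀ i → ∑[ b < p ] (S p b i ℤ.* S p b i) ≡ + p ℤ.- 1ℤ
  S-columns-norm i = trans (∑-cong p (λ b _ → cong₂ ℤ._*_ (S-column b i) (S-column b i)))
                           (∑-legendre-affine² (p ∸ i) 1≉0)

  S-columns-orthogonal : ∀ {i j} → i < p → j < p → i ≢ j → ∑[ b < p ] (S p b i ℤ.* S p b j) ≡ -1ℤ
  S-columns-orthogonal {i} {j} i<p j<p i≢j = trans (∑-cong p (λ b _ → cong₂ ℤ._*_ (S-column b i) (S-column b j)))
    (∑-legendre-correlation (p ∸ i) (p ∸ j) 1≉0 (λ e → i≢j (∸-injective i<p j<p e)))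

  S-rows-norm : ∀ a → ∑[ i < p ] (S p a i ℤ.* S p a i) ≡ + p ℤ.- 1ℤ
  S-rows-norm a = trans (∑-cong p (λ i i<p → cong₂ ℤ._*_ (S-row a i i<p) (S-row a i i<p)))
                        (∑-legendre-affine² a p∸1≉0)

  S-rows-orthogonal : ∀ {a b} → a < p → b < p → a ≢ b → ∑[ i < p ] (S p a i ℤ.* S p b i) ≡ -1ℤ
  S-rows-orthogonal {a} {b} a<p b<p a≢b = trans (∑-cong p (λ i i<p → cong₂ ℤ._*_ (S-row a i i<p) (S-row b i i<p)))
    (∑-legendre-correlation a b p∸1≉0 (λ e → a≢b (<-≈⇒≡ a<p b<p e)))

module RationalSums where

  open import Data.Nat as ℕ using (ℕ; zero; suc; _<_; s≤s; z≤n)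
  import Data.Nat.Properties as ℕ
  open import Data.Integer as ℤ using (ℤ; +_)
  import Data.Integer.Properties as ℤ
  open import Data.Rational as ℚ using (ℚ; 0ℚ; 1ℚ; ½; _+_; _*_; -_; _≤_; ∣_∣; toℚᵘ)
  import Data.Rational.Properties as ℚ
  open import Data.Rational.Unnormalised as ℚᵘ using (mkℚᵘ; *≡*; *≤*) renaming (_≃_ to _≃ᵘ_)
  import Data.Rational.Unnormalised.Properties as ℚᵘ
  open import Data.Rational.Solver using (module +-*-Solver)
  import Data.Sum
  open import Data.Sum using (inj₁; inj₂)
  open import Relation.Binary.PropositionalEquality using (_≡_; _≢_; refl; sym; trans; cong; cong₂; subst; module ≡-Reasoning)

  open +-*-Solver
  open RangeSum ℚ.+-*-commutativeRing
  private module ℤ∑ = RangeSum ℤ.+-*-commutativeRing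

  toℚᵘ-toℚ : ∀ z → toℚᵘ (toℚ z) ≃ᵘ mkℚᵘ z 0
  toℚᵘ-toℚ z = ℚ.toℚᵘ-fromℚᵘ (mkℚᵘ z 0)

  toℚ-+ : ∀ a b → toℚ (a ℤ.+ b) ≡ toℚ a + toℚ b
  toℚ-+ a b = ℚ.toℚᵘ-injective (ℚᵘ.≃-trans (toℚᵘ-toℚ (a ℤ.+ b))
    (ℚᵘ.≃-sym (ℚᵘ.≃-trans (ℚ.toℚᵘ-homo-+ (toℚ a) (toℚ b))
      (ℚᵘ.≃-trans (ℚᵘ.+-cong (toℚᵘ-toℚ a) (toℚᵘ-toℚ b)) (*≡* (cong (ℤ._* + 1) (cong₂ ℤ._+_ (ℤ.*-identityʳ a) (ℤ.*-identityʳ b))))))))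

  toℚ-* : ∀ a b → toℚ (a ℤ.* b) ≡ toℚ a * toℚ b
  toℚ-* a b = ℚ.toℚᵘ-injective (ℚᵘ.≃-trans (toℚᵘ-toℚ (a ℤ.* b))
    (ℚᵘ.≃-sym (ℚᵘ.≃-trans (ℚ.toℚᵘ-homo-* (toℚ a) (toℚ b)) (ℚᵘ.≃-trans (ℚᵘ.*-cong (toℚᵘ-toℚ a) (toℚᵘ-toℚ b)) (*≡* refl)))))

  toℚ-mono : ∀ {a b} → a ℤ.≤ b → toℚ a ≤ toℚ b
  toℚ-mono {a} {b} a≤b = ℚ.toℚᵘ-cancel-≤ (ℚᵘ.≤-respˡ-≃ (ℚᵘ.≃-sym (toℚᵘ-toℚ a))
    (ℚᵘ.≤-respʳ-≃ (ℚᵘ.≃-sym (toℚᵘ-toℚ b)) (*≤* (ℤ.*-monoʳ-≤-nonNeg (+ 1) a≤b))))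

  toℚ-∑ : ∀ n (f : ℕ → ℤ) → toℚ (ℤ∑.sumTo n f) ≡ ∑[ i < n ] toℚ (f i)
  toℚ-∑ zero f = trans (cong toℚ (ℤ∑.∑-0 f)) (sym (∑-0 (λ i → toℚ (f i))))
  toℚ-∑ (suc n) f = begin
    toℚ (ℤ∑.sumTo (suc n) f)                        ≡⟨ cong toℚ (ℤ∑.∑-suc n f) ⟩
    toℚ (f 0 ℤ.+ ℤ∑.sumTo n (λ i → f (suc i)))      ≡⟨ toℚ-+ (f 0) _ ⟩
    toℚ (f 0) + toℚ (ℤ∑.sumTo n (λ i → f (suc i)))  ≡⟨ cong (_+_ (toℚ (f 0))) (toℚ-∑ n (λ i → f (suc i))) ⟩
    toℚ (f 0) + ∑[ i < n ] toℚ (f (suc i))          ≡⟨ ∑-suc n (λ i → toℚ (f i)) ⟨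
    ∑[ i < suc n ] toℚ (f i)                        ∎
    where open ≡-Reasoning

  square : ℚ → ℚ
  square x = x * x

  square-* : ∀ u v → square (u * v) ≡ square u * square v
  square-* u v = solve 2 (λ u v → (u :* v) :* (u :* v) := (u :* u) :* (v :* v)) refl u v

  toℚ-square-≤ : ∀ {z n} → ℤ.∣ z ∣ ℕ.≤ n → square (toℚ z) ≤ toℚ (+ n) * toℚ (+ n)
  toℚ-square-≤ {z} {n} ∣z∣≤n = begin
    toℚ z * toℚ z                  ≡⟨ toℚ-* z z ⟨
    toℚ (z ℤ.* z)                  ≡⟨ cong toℚ (square-abs z) ⟩
    toℚ (+ (ℤ.∣ z ∣ ℕ.* ℤ.∣ z ∣))   ≤⟨ toℚ-mono (ℤ.+≤+ (ℕ.*-mono-≤ ∣z∣≤n ∣z∣≤n)) ⟩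
    toℚ (+ (n ℕ.* n))              ≡⟨ trans (cong toℚ (ℤ.pos-* n n)) (toℚ-* (+ n) (+ n)) ⟩
    toℚ (+ n) * toℚ (+ n)          ∎
    where
    open ℚ.≤-Reasoning
    square-abs : ∀ z → z ℤ.* z ≡ + (ℤ.∣ z ∣ ℕ.* ℤ.∣ z ∣)
    square-abs (+ n) = sym (ℤ.pos-* n n)
    square-abs ℤ.-[1+ n ] = refl

  square-nonNeg : ∀ x → 0ℚ ≤ square x
  square-nonNeg x = subst (0ℚ ≤_) (∣x∣²≡x² (ℚ.∣p∣≡p∨∣p∣≡-p x))
    (ℚ.nonNegative⁻¹ _ {{ℚ.nonNeg*nonNeg⇒nonNeg (∣ x ∣) {{∣x∣≥0}} (∣ x ∣) {{∣x∣≥0}}}})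
    where
    ∣x∣≥0 = ℚ.nonNegative (ℚ.0≤∣p∣ x)
    ∣x∣²≡x² : ∀ {y} → y ≡ x Data.Sum.⊎ y ≡ - x → y * y ≡ x * x
    ∣x∣²≡x² (inj₁ refl) = refl
    ∣x∣²≡x² (inj₂ refl) = solve 1 (λ x → (:- x) :* (:- x) := x :* x) refl x

  ≡+nonNeg⇒≤ : ∀ {a b} s → 0ℚ ≤ s → a ≡ b + s → b ≤ a
  ≡+nonNeg⇒≤ {a} {b} s s≥0 a≡b+s = ℚ.≤-trans (ℚ.≤-reflexive (sym (ℚ.+-identityʳ b)))
    (ℚ.≤-trans (ℚ.+-monoʳ-≤ b s≥0) (ℚ.≤-reflexive (sym a≡b+s)))

  *-monoˡ-≤ : ∀ {c a b} → 0ℚ ≤ c → a ≤ b → c * a ≤ c * b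
  *-monoˡ-≤ {c} c≥0 = ℚ.*-monoˡ-≤-nonNeg c {{ℚ.nonNegative c≥0}}

  *-monoʳ-≤ : ∀ {c a b} → 0ℚ ≤ c → a ≤ b → a * c ≤ b * c
  *-monoʳ-≤ {c} c≥0 = ℚ.*-monoʳ-≤-nonNeg c {{ℚ.nonNegative c≥0}}

  square-sum-≤ : ∀ u v → square (u + v) ≤ (square u + square u) + (square v + square v)
  square-sum-≤ u v = ≡+nonNeg⇒≤ ((u + - v) * (u + - v)) (square-nonNeg (u + - v))
    (solve 2 (λ u v → (u :* u :+ u :* u) :+ (v :* v :+ v :* v) := (u :+ v) :* (u :+ v) :+ (u :- v) :* (u :- v)) refl u v)

  square-difference-≤ : ∀ u v → square (u + - v) ≤ (square u + square u) + (square v + square v)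
  square-difference-≤ u v = ≡+nonNeg⇒≤ ((u + v) * (u + v)) (square-nonNeg (u + v))
    (solve 2 (λ u v → (u :* u :+ u :* u) :+ (v :* v :+ v :* v) := (u :- v) :* (u :- v) :+ (u :+ v) :* (u :+ v)) refl u v)

  +-double-injective : ∀ {y w} → y + y ≡ w + w → y ≡ w
  +-double-injective {y} {w} y+y≡w+w = begin
    y              ≡⟨ solve 1 (λ y → y := con ½ :* (y :+ y)) refl y ⟩
    ½ * (y + y)    ≡⟨ cong (½ *_) y+y≡w+w ⟩
    ½ * (w + w)    ≡⟨ solve 1 (λ w → con ½ :* (w :+ w) := w) refl w ⟩
    w              ∎
    where open ≡-Reasoning

  ∑-mono-≤ : ∀ n {f g : ℕ → ℚ} → (∀ i → i < n → f i ≤ g i) → ∑[ i < n ] f i ≤ ∑[ i < n ] g i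
  ∑-mono-≤ zero {f} {g} _ = ℚ.≤-reflexive (trans (∑-0 f) (sym (∑-0 g)))
  ∑-mono-≤ (suc n) {f} {g} f≤g = ℚ.≤-trans (ℚ.≤-reflexive (∑-suc n f))
    (ℚ.≤-trans (ℚ.+-mono-≤ (f≤g 0 (s≤s z≤n)) (∑-mono-≤ n (λ i i<n → f≤g (suc i) (s≤s i<n))))
               (ℚ.≤-reflexive (sym (∑-suc n g))))

  ∑-nonNeg : ∀ n {f : ℕ → ℚ} → (∀ i → i < n → 0ℚ ≤ f i) → 0ℚ ≤ ∑[ i < n ] f i
  ∑-nonNeg n {f} f≥0 = ℚ.≤-trans (ℚ.≤-reflexive (sym (∑-zero n {λ _ → 0ℚ} (λ _ _ → refl)))) (∑-mono-≤ n f≥0)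

  ∑-mono-≤-range : ∀ {m n} {f : ℕ → ℚ} → m ℕ.≤ n → (∀ i → 0ℚ ≤ f i) → ∑[ i < m ] f i ≤ ∑[ i < n ] f i
  ∑-mono-≤-range {zero} {n} {f} _ f≥0 = ℚ.≤-trans (ℚ.≤-reflexive (∑-0 f)) (∑-nonNeg n (λ i _ → f≥0 i))
  ∑-mono-≤-range {suc m} {suc n} {f} (s≤s m≤n) f≥0 = ℚ.≤-trans (ℚ.≤-reflexive (∑-suc m f))
    (ℚ.≤-trans (ℚ.+-monoʳ-≤ (f 0) (∑-mono-≤-range m≤n (λ i → f≥0 (suc i)))) (ℚ.≤-reflexive (sym (∑-suc n f))))

  module _ {n : ℕ} (K : ℕ → ℕ → ℚ)
    (norm : ∀ i → i < n → ∑[ b < n ] (K b i * K b i) ≡ toℚ (+ n) + - 1ℚ)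
    (orthogonal : ∀ {i j} → i < n → j < n → i ≢ j → ∑[ b < n ] (K b i * K b j) ≡ - 1ℚ) where

    gram-identity : ∀ (V : ℕ → ℚ) → ∑[ b < n ] square (∑[ i < n ] (K b i * V i)) + square (∑[ i < n ] V i) ≡ toℚ (+ n) * ∑[ i < n ] square (V i)
    gram-identity V = begin
      ∑[ b < n ] (∑[ i < n ] (K b i * V i) * ∑[ i < n ] (K b i * V i)) + ∑[ i < n ] V i * ∑[ i < n ] V i
        ≡⟨ cong₂ _+_ (∑-cong n (λ b _ → ∑-*-∑ n n (λ i → K b i * V i) (λ j → K b j * V j))) (∑-*-∑ n n V V) ⟩
      ∑[ b < n ] ∑[ i < n ] ∑[ j < n ] ((K b i * V i) * (K b j * V j)) + ∑[ i < n ] ∑[ j < n ] (V i * V j)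
        ≡⟨ cong (_+ ∑[ i < n ] ∑[ j < n ] (V i * V j)) (trans (∑-comm n n _) (∑-cong n (λ i _ → ∑-comm n n _))) ⟩
      ∑[ i < n ] ∑[ j < n ] ∑[ b < n ] ((K b i * V i) * (K b j * V j)) + ∑[ i < n ] ∑[ j < n ] (V i * V j)
        ≡⟨ cong (_+ ∑[ i < n ] ∑[ j < n ] (V i * V j)) (∑-cong n (λ i _ → ∑-cong n (λ j _ → factor i j))) ⟩
      ∑[ i < n ] ∑[ j < n ] (V i * V j * G i j) + ∑[ i < n ] ∑[ j < n ] (V i * V j)
        ≡⟨ trans (sym (∑-distrib-+ n _ _)) (∑-cong n (λ i _ → sym (∑-distrib-+ n _ _))) ⟩
      ∑[ i < n ] ∑[ j < n ] (V i * V j * G i j + V i * V j)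
        ≡⟨ ∑-cong n (λ i i<n → diagonal i i<n) ⟩
      ∑[ i < n ] (toℚ (+ n) * (V i * V i))
        ≡⟨ *-distribˡ-∑ n (toℚ (+ n)) (λ i → V i * V i) ⟨
      toℚ (+ n) * ∑[ i < n ] (V i * V i) ∎
      where
      open ≡-Reasoning
      G : ℕ → ℕ → ℚ
      G i j = ∑[ b < n ] (K b i * K b j)
      factor : ∀ i j → ∑[ b < n ] ((K b i * V i) * (K b j * V j)) ≡ V i * V j * G i j
      factor i j = trans (∑-cong n (λ b _ → solve 4 (λ x y u v → (x :* u) :* (y :* v) := (u :* v) :* (x :* y)) refl (K b i) (K b j) (V i) (V j)))
                         (sym (*-distribˡ-∑ n (V i * V j) (λ b → K b i * K b j)))
      diagonal : ∀ i → i < n → ∑[ j < n ] (V i * V j * G i j + V i * V j) ≡ toℚ (+ n) * (V i * V i)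
      diagonal i i<n = trans (∑-single n i i<n off) (begin
        V i * V i * G i i + V i * V i                     ≡⟨ cong (λ g → V i * V i * g + V i * V i) (norm i i<n) ⟩
        V i * V i * (toℚ (+ n) + - 1ℚ) + V i * V i        ≡⟨ solve 2 (λ w m → w :* (m :- con 1ℚ) :+ w := m :* w) refl (V i * V i) (toℚ (+ n)) ⟩
        toℚ (+ n) * (V i * V i)                           ∎)
        where
        off : ∀ j → j < n → j ≢ i → V i * V j * G i j + V i * V j ≡ 0ℚ
        off j j<n j≢i = trans (cong (λ g → V i * V j * g + V i * V j) (orthogonal i<n j<n (λ i≡j → j≢i (sym i≡j))))
                              (solve 1 (λ w → w :* (:- con 1ℚ) :+ w := con 0ℚ) refl (V i * V j))

    gram-bound : ∀ (V : ℕ → ℚ) → ∑[ b < n ] square (∑[ i < n ] (K b i * V i)) ≤ toℚ (+ n) * ∑[ i < n ] square (V i)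
    gram-bound V = ≡+nonNeg⇒≤ _ (square-nonNeg (∑[ i < n ] V i)) (sym (gram-identity V))

module Rows where

  open import Data.Bool using (Bool; true; false; if_then_else_; not; _∧_; T)
  open import Data.Nat as ℕ using (ℕ; zero; suc; _<_; _≡ᵇ_; NonZero)
  import Data.Nat.Properties as ℕ
  open import Data.Integer as ℤ using (ℤ)
  open import Data.Rational as ℚ using (ℚ; 0ℚ; _+_; _*_)
  import Data.Rational.Properties as ℚ
  open import Data.Rational.Solver using (module +-*-Solver)
  open import Data.List using (List; []; _∷_; map; _++_; upTo; concatMap)
  open import Data.Product using (_,_)
  open import Data.Empty using (⊥-elim)
  open import Relation.Nullary using (yes; no)
  open import Relation.Binary.Definitions using (tri<; tri≈; tri>)
  open import Relation.Binary.PropositionalEquality using (_≡_; _≢_; refl; sym; trans; cong; cong₂; subst; module ≡-Reasoning)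
  open RationalSums

  open RangeSum ℚ.+-*-commutativeRing
  open +-*-Solver

  ≡ᵇ-refl : ∀ k → (k ≡ᵇ k) ≡ true
  ≡ᵇ-refl k with k ≡ᵇ k in eq
  ... | true = refl
  ... | false = ⊥-elim (subst T eq (ℕ.≡⇒≡ᵇ k k refl))

  ≡ᵇ-≢ : ∀ {m n} → m ≢ n → (m ≡ᵇ n) ≡ false
  ≡ᵇ-≢ {m} {n} m≢n with m ≡ᵇ n in eq
  ... | true = ⊥-elim (m≢n (ℕ.≡ᵇ⇒≡ m n (subst T (sym eq) _)))
  ... | false = refl

  ≡ᵇ-∧-≡ᵇ : ∀ {k m n} → m ≢ n → (k ≡ᵇ m) ∧ (k ≡ᵇ n) ≡ false
  ≡ᵇ-∧-≡ᵇ {k} {m} {n} m≢n with k ℕ.≟ m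
  ... | yes refl = trans (cong (_∧ (k ≡ᵇ n)) (≡ᵇ-refl k)) (≡ᵇ-≢ m≢n)
  ... | no k≢m = cong (_∧ (k ≡ᵇ n)) (≡ᵇ-≢ k≢m)

  ≡ᵇ-∧-≡ᵇ′ : ∀ {k m n} → m ≢ n → (m ≡ᵇ k) ∧ (n ≡ᵇ k) ≡ false
  ≡ᵇ-∧-≡ᵇ′ {k} {m} {n} m≢n with m ℕ.≟ k
  ... | yes refl = trans (cong (_∧ (n ≡ᵇ m)) (≡ᵇ-refl m)) (≡ᵇ-≢ (λ n≡m → m≢n (sym n≡m)))
  ... | no m≢k = cong (_∧ (n ≡ᵇ k)) (≡ᵇ-≢ m≢k)

  ∑∑-+ : ∀ m n (f g : ℕ → ℕ → ℚ) → ∑[ i < m ] ∑[ j < n ] (f i j + g i j) ≡ ∑[ i < m ] ∑[ j < n ] f i j + ∑[ i < m ] ∑[ j < n ] g i j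
  ∑∑-+ m n f g = trans (∑-cong m (λ i _ → ∑-distrib-+ n (f i) (g i))) (∑-distrib-+ m _ _)

  sumℚ-++ : ∀ (xs ys : List ℚ) → sumℚ (xs ++ ys) ≡ sumℚ xs + sumℚ ys
  sumℚ-++ [] ys = sym (ℚ.+-identityˡ (sumℚ ys))
  sumℚ-++ (x ∷ xs) ys = trans (cong (x +_) (sumℚ-++ xs ys)) (sym (ℚ.+-assoc x (sumℚ xs) (sumℚ ys)))

  sum-pairs : ∀ n (F : Pair → ℚ) → sumℚ (map F (pairs n)) ≡ ∑[ b < n ] ∑[ a < b ] F (a , b)
  sum-pairs n F = trans (over-concat (upTo n)) (trans (∑-upTo n _) (∑-cong n (λ b _ → trans (cong sumℚ (sym (map-∘ (upTo b)))) (∑-upTo b (λ a → F (a , b))))))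
    where
    open import Data.List.Properties using (map-∘; map-++)
    row : ℕ → List Pair
    row b = map (λ a → (a , b)) (upTo b)
    over-concat : ∀ bs → sumℚ (map F (concatMap row bs)) ≡ sumℚ (map (λ b → sumℚ (map F (row b))) bs)
    over-concat [] = refl
    over-concat (b ∷ bs) = trans (cong sumℚ (map-++ F (row b) (concatMap row bs)))
      (trans (sumℚ-++ (map F (row b)) (map F (concatMap row bs))) (cong (sumℚ (map F (row b)) +_) (over-concat bs)))

  ∑∑-symmetric : ∀ n (G : ℕ → ℕ → ℚ) → (∀ a b → G a b ≡ G b a) → (∀ a → G a a ≡ 0ℚ) →
    ∑[ a < n ] ∑[ b < n ] G a b ≡ ∑[ b < n ] ∑[ a < b ] G a b + ∑[ b < n ] ∑[ a < b ] G a b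
  ∑∑-symmetric zero G _ _ = trans (∑-0 _) (sym (trans (cong₂ _+_ (∑-0 _) (∑-0 _)) (ℚ.+-identityʳ 0ℚ)))
  ∑∑-symmetric (suc n) G G-sym G-diag = begin
    ∑[ a < suc n ] ∑[ b < suc n ] G a b
      ≡⟨ ∑-cong (suc n) (λ a _ → ∑-last n (G a)) ⟩
    ∑[ a < suc n ] (∑[ b < n ] G a b + G a n)
      ≡⟨ ∑-last n (λ a → ∑[ b < n ] G a b + G a n) ⟩
    ∑[ a < n ] (∑[ b < n ] G a b + G a n) + (∑[ b < n ] G n b + G n n)
      ≡⟨ cong₂ _+_ (∑-distrib-+ n (λ a → ∑[ b < n ] G a b) (λ a → G a n))
                   (cong₂ _+_ (∑-cong n (λ b _ → G-sym n b)) (G-diag n)) ⟩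
    (∑[ a < n ] ∑[ b < n ] G a b + A) + (A + 0ℚ)
      ≡⟨ cong (λ s → (s + A) + (A + 0ℚ)) (∑∑-symmetric n G G-sym G-diag) ⟩
    ((Δ + Δ) + A) + (A + 0ℚ)
      ≡⟨ solve 2 (λ Δ A → ((Δ :+ Δ) :+ A) :+ (A :+ con 0ℚ) := (Δ :+ A) :+ (Δ :+ A)) refl Δ A ⟩
    (Δ + A) + (Δ + A)
      ≡⟨ cong₂ _+_ (∑-last n (λ b → ∑[ a < b ] G a b)) (∑-last n (λ b → ∑[ a < b ] G a b)) ⟨
    ∑[ b < suc n ] ∑[ a < b ] G a b + ∑[ b < suc n ] ∑[ a < b ] G a b ∎
    where
    open ≡-Reasoning
    A = ∑[ a < n ] G a n
    Δ = ∑[ b < n ] ∑[ a < b ] G a b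

  guard : Bool → ℚ → ℚ
  guard B q = if B then q else 0ℚ

  -- The body of U431 with the tests a ≡ᵇ c, a ≡ᵇ d, b ≡ᵇ c, b ≡ᵇ d abstracted to B₁ … B₄.
  intersection-entry : Bool → Bool → Bool → Bool → ℤ → ℤ → ℤ → ℤ → ℤ
  intersection-entry B₁ B₂ B₃ B₄ t₁ t₂ t₃ t₄ =
    if (b2n B₁ ℕ.+ b2n B₂ ℕ.+ b2n B₃ ℕ.+ b2n B₄) ≡ᵇ 1
    then (if B₁ then t₁ else if B₂ then t₂ else if B₃ then t₃ else t₄)
    else ℤ.+ 0

  intersection-entry-split : ∀ B₁ B₂ B₃ B₄ t₁ t₂ t₃ t₄ →
    B₁ ∧ B₂ ≡ false → B₃ ∧ B₄ ≡ false → B₁ ∧ B₃ ≡ false → B₂ ∧ B₄ ≡ false →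
    toℚ (intersection-entry B₁ B₂ B₃ B₄ t₁ t₂ t₃ t₄)
      ≡ ((guard B₁ (guard (not B₄) (toℚ t₁)) + guard B₂ (guard (not B₃) (toℚ t₂)))
          + guard B₃ (guard (not B₂) (toℚ t₃))) + guard B₄ (guard (not B₁) (toℚ t₄))
  intersection-entry-split true true _ _ _ _ _ _ () _ _ _
  intersection-entry-split _ _ true true _ _ _ _ _ () _ _
  intersection-entry-split true false true false _ _ _ _ _ _ () _
  intersection-entry-split false true false true _ _ _ _ _ _ _ ()
  intersection-entry-split false false false false _ _ _ _ _ _ _ _ = refl
  intersection-entry-split true false false true _ _ _ _ _ _ _ _ = refl
  intersection-entry-split false true true false _ _ _ _ _ _ _ _ = refl
  intersection-entry-split true false false false t₁ _ _ _ _ _ _ _ =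
    solve 1 (λ t → t := ((t :+ con 0ℚ) :+ con 0ℚ) :+ con 0ℚ) refl (toℚ t₁)
  intersection-entry-split false true false false _ t₂ _ _ _ _ _ _ =
    solve 1 (λ t → t := ((con 0ℚ :+ t) :+ con 0ℚ) :+ con 0ℚ) refl (toℚ t₂)
  intersection-entry-split false false true false _ _ t₃ _ _ _ _ _ =
    solve 1 (λ t → t := ((con 0ℚ :+ con 0ℚ) :+ t) :+ con 0ℚ) refl (toℚ t₃)
  intersection-entry-split false false false true _ _ _ t₄ _ _ _ _ =
    solve 1 (λ t → t := ((con 0ℚ :+ con 0ℚ) :+ con 0ℚ) :+ t) refl (toℚ t₄)

  module RowExpansion (p : ℕ) .{{_ : NonZero p}} (x : Pair → ℚ) where

    X : ℕ → ℕ → ℚ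
    X a c with ℕ.<-cmp a c
    ... | tri< _ _ _ = x (a , c)
    ... | tri≈ _ _ _ = 0ℚ
    ... | tri> _ _ _ = x (c , a)

    X-< : ∀ {a c} → a < c → X a c ≡ x (a , c)
    X-< {a} {c} a<c with ℕ.<-cmp a c
    ... | tri< _ _ _ = refl
    ... | tri≈ a≮c _ _ = ⊥-elim (a≮c a<c)
    ... | tri> a≮c _ _ = ⊥-elim (a≮c a<c)

    X-diagonal : ∀ a → X a a ≡ 0ℚ
    X-diagonal a with ℕ.<-cmp a a
    ... | tri< a<a _ _ = ⊥-elim (ℕ.<-irrefl refl a<a)
    ... | tri≈ _ _ _ = refl
    ... | tri> _ _ a<a = ⊥-elim (ℕ.<-irrefl refl a<a)

    X-sym : ∀ a c → X a c ≡ X c a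
    X-sym a c with ℕ.<-cmp a c | ℕ.<-cmp c a
    ... | tri< _ _ _ | tri> _ _ _ = refl
    ... | tri≈ _ _ _ | tri≈ _ _ _ = refl
    ... | tri> _ _ _ | tri< _ _ _ = refl
    ... | tri< a<c _ _ | tri< c<a _ _ = ⊥-elim (ℕ.<-asym a<c c<a)
    ... | tri< _ a≢c _ | tri≈ _ c≡a _ = ⊥-elim (a≢c (sym c≡a))
    ... | tri≈ _ a≡c _ | tri< _ c≢a _ = ⊥-elim (c≢a (sym a≡c))
    ... | tri≈ _ a≡c _ | tri> _ c≢a _ = ⊥-elim (c≢a (sym a≡c))
    ... | tri> _ a≢c _ | tri≈ _ c≡a _ = ⊥-elim (a≢c (sym c≡a))
    ... | tri> _ _ c<a | tri> _ _ a<c = ⊥-elim (ℕ.<-asym a<c c<a)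

    t : ℕ → ℕ → ℕ → ℚ
    t a b c = toℚ (tri p a b c)

    coefficient : ℕ → ℕ → ℕ → ℚ
    coefficient u v d = guard (not (v ≡ᵇ d)) (t u v d)

    -- Z u v collects the entries of row {u,v} in the columns {u,d}; d = v is excluded, as there the pairs coincide.
    Z : ℕ → ℕ → ℚ
    Z u v = ∑[ d < p ] (coefficient u v d * X u d)

    sift-row : ∀ k → k < p → (h : ℕ → ℚ) → ∑[ c < p ] ∑[ d < p ] (guard (k ≡ᵇ c) (h d) * X c d) ≡ ∑[ d < p ] (h d * X k d)
    sift-row k k<p h = trans (∑-single p k k<p others) (∑-cong p (λ d _ → cong (λ B → guard B (h d) * X k d) (≡ᵇ-refl k)))
      where
      others : ∀ c → c < p → c ≢ k → ∑[ d < p ] (guard (k ≡ᵇ c) (h d) * X c d) ≡ 0ℚ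
      others c _ c≢k = ∑-zero p (λ d _ → trans (cong (λ B → guard B (h d) * X c d) (≡ᵇ-≢ (λ k≡c → c≢k (sym k≡c))))
                                                (ℚ.*-zeroˡ (X c d)))

    sift-column : ∀ k → k < p → (h : ℕ → ℚ) → ∑[ c < p ] ∑[ d < p ] (guard (k ≡ᵇ d) (h c) * X c d) ≡ ∑[ c < p ] (h c * X k c)
    sift-column k k<p h = ∑-cong p (λ c _ → trans (∑-single p k k<p (others c))
      (cong₂ (λ B y → guard B (h c) * y) (≡ᵇ-refl k) (X-sym c k)))
      where
      others : ∀ c d → d < p → d ≢ k → guard (k ≡ᵇ d) (h c) * X c d ≡ 0ℚ
      others c d _ d≢k = trans (cong (λ B → guard B (h c) * X c d) (≡ᵇ-≢ (λ k≡d → d≢k (sym k≡d)))) (ℚ.*-zeroˡ (X c d))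

    module _ {a b} (a<b : a < b) (b<p : b < p) where

      H : ℕ → ℕ → ℚ
      H c d = ((guard (a ≡ᵇ c) (coefficient a b d) + guard (a ≡ᵇ d) (coefficient a b c))
                + guard (b ≡ᵇ c) (coefficient b a d)) + guard (b ≡ᵇ d) (coefficient b a c)

      H-sym : ∀ c d → H c d ≡ H d c
      H-sym c d = solve 4 (λ u v w z → ((u :+ v) :+ w) :+ z := ((v :+ u) :+ z) :+ w) refl
        (guard (a ≡ᵇ c) (coefficient a b d)) (guard (a ≡ᵇ d) (coefficient a b c))
        (guard (b ≡ᵇ c) (coefficient b a d)) (guard (b ≡ᵇ d) (coefficient b a c))

      U431≡H : ∀ {c d} → c < d → toℚ (U431 p (a , b) (c , d)) ≡ H c d
      U431≡H {c} {d} c<d = intersection-entry-split (a ≡ᵇ c) (a ≡ᵇ d) (b ≡ᵇ c) (b ≡ᵇ d)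
        (tri p a b d) (tri p a b c) (tri p b a d) (tri p b a c)
        (≡ᵇ-∧-≡ᵇ {a} (ℕ.<⇒≢ c<d)) (≡ᵇ-∧-≡ᵇ {b} (ℕ.<⇒≢ c<d)) (≡ᵇ-∧-≡ᵇ′ {c} (ℕ.<⇒≢ a<b)) (≡ᵇ-∧-≡ᵇ′ {d} (ℕ.<⇒≢ a<b))

      F T₁ T₂ T₃ T₄ : ℕ → ℕ → ℚ
      F c d = H c d * X c d
      T₁ c d = guard (a ≡ᵇ c) (coefficient a b d) * X c d
      T₂ c d = guard (a ≡ᵇ d) (coefficient a b c) * X c d
      T₃ c d = guard (b ≡ᵇ c) (coefficient b a d) * X c d
      T₄ c d = guard (b ≡ᵇ d) (coefficient b a c) * X c d

      row : ℚ
      row = sumℚ (map (λ Q → toℚ (U431 p (a , b) Q) * x Q) (pairs p))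

      -- F is symmetric with zero diagonal, so the row, a sum over c < d, is half of the full double sum.
      row+row≡∑∑F : row + row ≡ ∑[ c < p ] ∑[ d < p ] F c d
      row+row≡∑∑F = trans (cong₂ _+_ row≡ row≡) (sym (∑∑-symmetric p F F-sym F-diagonal))
        where
        row≡ : row ≡ ∑[ d < p ] ∑[ c < d ] F c d
        row≡ = trans (sum-pairs p (λ Q → toℚ (U431 p (a , b) Q) * x Q))
                     (∑-cong p (λ d _ → ∑-cong d (λ c c<d → cong₂ _*_ (U431≡H c<d) (sym (X-< c<d)))))
        F-sym : ∀ c d → F c d ≡ F d c
        F-sym c d = cong₂ _*_ (H-sym c d) (X-sym c d)
        F-diagonal : ∀ c → F c c ≡ 0ℚ
        F-diagonal c = trans (cong (H c c *_) (X-diagonal c)) (ℚ.*-zeroʳ (H c c))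

      ∑∑F≡2Z : ∑[ c < p ] ∑[ d < p ] F c d ≡ (Z a b + Z b a) + (Z a b + Z b a)
      ∑∑F≡2Z = begin
        ∑[ c < p ] ∑[ d < p ] F c d
          ≡⟨ ∑-cong p (λ c _ → ∑-cong p (λ d _ → distribute c d)) ⟩
        ∑[ c < p ] ∑[ d < p ] (((T₁ c d + T₂ c d) + T₃ c d) + T₄ c d)
          ≡⟨ trans (∑∑-+ p p _ T₄) (cong (_+ ∑[ c < p ] ∑[ d < p ] T₄ c d) (trans (∑∑-+ p p _ T₃)
               (cong (_+ ∑[ c < p ] ∑[ d < p ] T₃ c d) (∑∑-+ p p T₁ T₂)))) ⟩
        ((∑[ c < p ] ∑[ d < p ] T₁ c d + ∑[ c < p ] ∑[ d < p ] T₂ c d) + ∑[ c < p ] ∑[ d < p ] T₃ c d) + ∑[ c < p ] ∑[ d < p ] T₄ c d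
          ≡⟨ cong₂ _+_ (cong₂ _+_ (cong₂ _+_ (sift-row a a<p (coefficient a b)) (sift-column a a<p (coefficient a b)))
                                  (sift-row b b<p (coefficient b a)))
                       (sift-column b b<p (coefficient b a)) ⟩
        ((Z a b + Z a b) + Z b a) + Z b a
          ≡⟨ solve 2 (λ u v → ((u :+ u) :+ v) :+ v := (u :+ v) :+ (u :+ v)) refl (Z a b) (Z b a) ⟩
        (Z a b + Z b a) + (Z a b + Z b a) ∎
        where
        open ≡-Reasoning
        a<p = ℕ.<-trans a<b b<p
        distribute : ∀ c d → F c d ≡ ((T₁ c d + T₂ c d) + T₃ c d) + T₄ c d
        distribute c d = solve 5 (λ u v w z y → (((u :+ v) :+ w) :+ z) :* y := ((u :* y :+ v :* y) :+ w :* y) :+ z :* y) refl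
          (guard (a ≡ᵇ c) (coefficient a b d)) (guard (a ≡ᵇ d) (coefficient a b c))
          (guard (b ≡ᵇ c) (coefficient b a d)) (guard (b ≡ᵇ d) (coefficient b a c)) (X c d)

      row-expansion : row ≡ Z a b + Z b a
      row-expansion = +-double-injective (trans row+row≡∑∑F ∑∑F≡2Z)

module NormBound (p : ℕ) (prime : Prime p) (p≢2 : p ≢ 2) (x : Pair → ℚ) where

  open import Data.Bool using (true; false; not; _∧_)
  open import Data.Nat as ℕ using (ℕ; _<_; _≡ᵇ_; z≤n)
  import Data.Nat.Properties as ℕ
  open import Data.Integer as ℤ using (ℤ; +_; 0ℤ; -1ℤ)
  import Data.Integer.Properties as ℤ
  open import Data.Rational as ℚ using (ℚ; 0ℚ; 1ℚ; _+_; _*_; -_; _≤_)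
  import Data.Rational.Properties as ℚ
  open import Data.Rational.Solver using (module +-*-Solver)
  import Data.Nat.Solver
  open import Data.List using (map; upTo)
  open import Data.Product using (_,_)
  open import Data.Empty using (⊥-elim)
  open import Relation.Nullary using (yes; no)
  open import Relation.Binary.PropositionalEquality using (_≡_; _≢_; refl; sym; trans; cong; cong₂; subst; module ≡-Reasoning)
  open RationalSums
  open Rows

  open PrimeField p prime using (p≢0)
  open IntegerSums using (sumℤ-filter; ∣∑∣≤)
  open Jacobsthal p prime p≢2
  open RowExpansion p x
  open RangeSum ℚ.+-*-commutativeRing
  private module ℤ∑ = RangeSum ℤ.+-*-commutativeRing

  s : ℕ → ℕ → ℚ
  s b i = toℚ (S p b i)

  tri≡∑ : ∀ {a b c} → a < p → b < p → c < p → tri p a b c ≡ ℤ∑.sumTo p (λ i → S p a i ℤ.* S p b i ℤ.* S p c i)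
  tri≡∑ {a} {b} {c} a<p b<p c<p = trans (sumℤ-filter _ _ vanish (upTo p)) (ℤ∑.∑-upTo p _)
    where
    vanish : ∀ i → not (i ≡ᵇ a) ∧ not (i ≡ᵇ b) ∧ not (i ≡ᵇ c) ≡ false → S p a i ℤ.* S p b i ℤ.* S p c i ≡ 0ℤ
    vanish i excluded with i ℕ.≟ a | i ℕ.≟ b | i ℕ.≟ c
    ... | yes refl | _ | _ = cong (λ z → z ℤ.* S p b i ℤ.* S p c i) (S-diagonal a<p)
    ... | no _ | yes refl | _ = trans (cong (λ z → S p a i ℤ.* z ℤ.* S p c i) (S-diagonal b<p))
                                      (cong (ℤ._* S p c i) (ℤ.*-zeroʳ (S p a i)))
    ... | no _ | no _ | yes refl = trans (cong (ℤ._*_ (S p a i ℤ.* S p b i)) (S-diagonal c<p)) (ℤ.*-zeroʳ (S p a i ℤ.* S p b i))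
    ... | no i≢a | no i≢b | no i≢c = ⊥-elim (true≢false (trans (sym (cong₂ (λ u v → not u ∧ v) (≡ᵇ-≢ i≢a)
                                        (cong₂ (λ u w → not u ∧ not w) (≡ᵇ-≢ i≢b) (≡ᵇ-≢ i≢c)))) excluded))
      where
      true≢false : true ≢ false
      true≢false ()

  t≡∑ : ∀ {a b c} → a < p → b < p → c < p → t a b c ≡ ∑[ i < p ] (s a i * s b i * s c i)
  t≡∑ {a} {b} {c} a<p b<p c<p = begin
    toℚ (tri p a b c)                                          ≡⟨ cong toℚ (tri≡∑ a<p b<p c<p) ⟩
    toℚ (ℤ∑.sumTo p (λ i → S p a i ℤ.* S p b i ℤ.* S p c i))   ≡⟨ toℚ-∑ p (λ i → S p a i ℤ.* S p b i ℤ.* S p c i) ⟩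
    ∑[ i < p ] toℚ (S p a i ℤ.* S p b i ℤ.* S p c i)           ≡⟨ ∑-cong p (λ i _ → trans (toℚ-* (S p a i ℤ.* S p b i) (S p c i)) (cong (_* s c i) (toℚ-* (S p a i) (S p b i)))) ⟩
    ∑[ i < p ] (s a i * s b i * s c i)                         ∎
    where open ≡-Reasoning

  P : ℚ
  P = toℚ (+ p)

  toℚ-∑-* : ∀ (f g : ℕ → ℤ) → toℚ (ℤ∑.sumTo p (λ b → f b ℤ.* g b)) ≡ ∑[ b < p ] (toℚ (f b) * toℚ (g b))
  toℚ-∑-* f g = trans (toℚ-∑ p (λ b → f b ℤ.* g b)) (∑-cong p (λ b _ → toℚ-* (f b) (g b)))

  s-columns-norm : ∀ i → i < p → ∑[ b < p ] (s b i * s b i) ≡ P + - 1ℚ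
  s-columns-norm i _ = trans (sym (toℚ-∑-* (λ b → S p b i) (λ b → S p b i)))
                             (trans (cong toℚ (S-columns-norm i)) (toℚ-+ (+ p) -1ℤ))

  s-columns-orthogonal : ∀ {i j} → i < p → j < p → i ≢ j → ∑[ b < p ] (s b i * s b j) ≡ - 1ℚ
  s-columns-orthogonal {i} {j} i<p j<p i≢j = trans (sym (toℚ-∑-* (λ b → S p b i) (λ b → S p b j)))
                                                   (cong toℚ (S-columns-orthogonal i<p j<p i≢j))

  s-rows-norm : ∀ a → a < p → ∑[ i < p ] (s a i * s a i) ≡ P + - 1ℚ
  s-rows-norm a _ = trans (sym (toℚ-∑-* (S p a) (S p a))) (trans (cong toℚ (S-rows-norm a)) (toℚ-+ (+ p) -1ℤ))

  s-rows-orthogonal : ∀ {a b} → a < p → b < p → a ≢ b → ∑[ i < p ] (s a i * s b i) ≡ - 1ℚ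
  s-rows-orthogonal {a} {b} a<p b<p a≢b = trans (sym (toℚ-∑-* (S p a) (S p b)))
                                                (cong toℚ (S-rows-orthogonal a<p b<p a≢b))

  s²≤1 : ∀ b i → square (s b i) ≤ 1ℚ
  s²≤1 b i = toℚ-square-≤ {S p b i} (∣S∣≤1 b i)

  t²≤P² : ∀ {a b} → a < p → b < p → square (t a b b) ≤ P * P
  t²≤P² {a} {b} a<p b<p = toℚ-square-≤ {tri p a b b} (subst (λ z → ℤ.∣ z ∣ ℕ.≤ p) (sym (tri≡∑ a<p b<p b<p)) (∣∑∣≤ p _ ∣term∣≤1))
    where
    ∣term∣≤1 : ∀ i → ℤ.∣ S p a i ℤ.* S p b i ℤ.* S p b i ∣ ℕ.≤ 1
    ∣term∣≤1 i = subst (ℕ._≤ 1) (sym (trans (ℤ.abs-* (S p a i ℤ.* S p b i) (S p b i)) (cong (ℕ._* ℤ.∣ S p b i ∣) (ℤ.abs-* (S p a i) (S p b i)))))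
                       (ℕ.*-mono-≤ (ℕ.*-mono-≤ (∣S∣≤1 a i) (∣S∣≤1 b i)) (∣S∣≤1 b i))

  W : ℕ → ℕ → ℚ
  W a i = ∑[ c < p ] (s c i * X a c)

  Ẑ : ℕ → ℕ → ℚ
  Ẑ u v = ∑[ d < p ] (t u v d * X u d)

  E : ℕ → ℕ → ℚ
  E u v = t u v v * X u v

  M : ℕ → ℚ
  M a = ∑[ c < p ] square (X a c)

  Z≡Ẑ-E : ∀ u {v} → v < p → Z u v ≡ Ẑ u v + - E u v
  Z≡Ẑ-E u {v} v<p = begin
    Z u v                                        ≡⟨ solve 2 (λ z e → z := (z :+ e) :+ :- e) refl (Z u v) (E u v) ⟩
    (Z u v + E u v) + - E u v                     ≡⟨ cong (λ w → (Z u v + w) + - E u v) (sym excluded-term) ⟩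
    (Z u v + ∑[ d < p ] excluded d) + - E u v     ≡⟨ cong (_+ - E u v) (∑-distrib-+ p _ excluded) ⟨
    ∑[ d < p ] (coefficient u v d * X u d + excluded d) + - E u v ≡⟨ cong (_+ - E u v) (∑-cong p (λ d _ → recombine d)) ⟩
    Ẑ u v + - E u v                              ∎
    where
    open ≡-Reasoning
    open +-*-Solver
    excluded : ℕ → ℚ
    excluded d = guard (v ≡ᵇ d) (t u v d) * X u d
    excluded-term : ∑[ d < p ] excluded d ≡ E u v
    excluded-term = trans (∑-single p v v<p (λ d _ d≢v → trans (cong (λ B → guard B (t u v d) * X u d) (≡ᵇ-≢ (λ v≡d → d≢v (sym v≡d))))
                                                                 (ℚ.*-zeroˡ (X u d))))
                          (cong (λ B → guard B (t u v v) * X u v) (≡ᵇ-refl v))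
    recombine : ∀ d → coefficient u v d * X u d + excluded d ≡ t u v d * X u d
    recombine d with v ≡ᵇ d
    ... | true = trans (cong (_+ t u v d * X u d) (ℚ.*-zeroˡ (X u d))) (ℚ.+-identityˡ _)
    ... | false = trans (cong (_+_ (t u v d * X u d)) (ℚ.*-zeroˡ (X u d))) (ℚ.+-identityʳ _)

  Ẑ≡∑sW : ∀ {u v} → u < p → v < p → Ẑ u v ≡ ∑[ i < p ] (s v i * (s u i * W u i))
  Ẑ≡∑sW {u} {v} u<p v<p = begin
    ∑[ d < p ] (t u v d * X u d)                          ≡⟨ ∑-cong p (λ d d<p → cong (_* X u d) (t≡∑ u<p v<p d<p)) ⟩
    ∑[ d < p ] (∑[ i < p ] (s u i * s v i * s d i) * X u d) ≡⟨ ∑-cong p (λ d _ → *-distribʳ-∑ p (X u d) _) ⟩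
    ∑[ d < p ] ∑[ i < p ] (s u i * s v i * s d i * X u d) ≡⟨ ∑-comm p p _ ⟩
    ∑[ i < p ] ∑[ d < p ] (s u i * s v i * s d i * X u d) ≡⟨ ∑-cong p (λ i _ → ∑-cong p (λ d _ → regroup i d)) ⟩
    ∑[ i < p ] ∑[ d < p ] (s v i * s u i * (s d i * X u d)) ≡⟨ ∑-cong p (λ i _ → *-distribˡ-∑ p (s v i * s u i) _) ⟨
    ∑[ i < p ] (s v i * s u i * W u i)                    ≡⟨ ∑-cong p (λ i _ → ℚ.*-assoc (s v i) (s u i) (W u i)) ⟩
    ∑[ i < p ] (s v i * (s u i * W u i))                  ∎
    where
    open ≡-Reasoning
    open +-*-Solver
    regroup : ∀ i d → s u i * s v i * s d i * X u d ≡ s v i * s u i * (s d i * X u d)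
    regroup i d = solve 4 (λ a b c y → a :* b :* c :* y := b :* a :* (c :* y)) refl (s u i) (s v i) (s d i) (X u d)

  P≥0 : 0ℚ ≤ P
  P≥0 = toℚ-mono {0ℤ} {+ p} (ℤ.+≤+ z≤n)

  ∑Ẑ²≤ : ∀ {a} → a < p → ∑[ b < p ] square (Ẑ a b) ≤ P * (P * M a)
  ∑Ẑ²≤ {a} a<p = begin
    ∑[ b < p ] square (Ẑ a b)                      ≡⟨ ∑-cong p (λ b b<p → cong square (Ẑ≡∑sW a<p b<p)) ⟩
    ∑[ b < p ] square (∑[ i < p ] (s b i * V i))   ≤⟨ gram-bound {p} s s-columns-norm s-columns-orthogonal V ⟩
    P * ∑[ i < p ] square (V i)                    ≤⟨ *-monoˡ-≤ P≥0 (∑-mono-≤ p (λ i _ → V²≤W² i)) ⟩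
    P * ∑[ i < p ] square (W a i)                  ≤⟨ *-monoˡ-≤ P≥0 (gram-bound {p} (λ i c → s c i) s-rows-norm s-rows-orthogonal (X a)) ⟩
    P * (P * M a)                                  ∎
    where
    open ℚ.≤-Reasoning
    V : ℕ → ℚ
    V i = s a i * W a i
    V²≤W² : ∀ i → square (V i) ≤ square (W a i)
    V²≤W² i = begin
      square (s a i * W a i)          ≡⟨ square-* (s a i) (W a i) ⟩
      square (s a i) * square (W a i) ≤⟨ *-monoʳ-≤ (square-nonNeg (W a i)) (s²≤1 a i) ⟩
      1ℚ * square (W a i)             ≡⟨ ℚ.*-identityˡ _ ⟩
      square (W a i)                  ∎

  ∑E²≤ : ∀ {a} → a < p → ∑[ b < p ] square (E a b) ≤ P * P * M a
  ∑E²≤ {a} a<p = begin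
    ∑[ b < p ] square (E a b)                    ≤⟨ ∑-mono-≤ p (λ b b<p → E²≤ b b<p) ⟩
    ∑[ b < p ] (P * P * square (X a b))          ≡⟨ *-distribˡ-∑ p (P * P) (λ b → square (X a b)) ⟨
    P * P * M a                                  ∎
    where
    open ℚ.≤-Reasoning
    E²≤ : ∀ b → b < p → square (E a b) ≤ P * P * square (X a b)
    E²≤ b b<p = ℚ.≤-trans (ℚ.≤-reflexive (square-* (t a b b) (X a b))) (*-monoʳ-≤ (square-nonNeg (X a b)) (t²≤P² a<p b<p))

  Q : ℚ
  Q = (P * P + P * P) + (P * P + P * P)

  ∑Z²≤ : ∀ {a} → a < p → ∑[ b < p ] square (Z a b) ≤ Q * M a
  ∑Z²≤ {a} a<p = begin
    ∑[ b < p ] square (Z a b)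
      ≤⟨ ∑-mono-≤ p (λ b b<p → ℚ.≤-trans (ℚ.≤-reflexive (cong square (Z≡Ẑ-E a b<p))) (square-difference-≤ (Ẑ a b) (E a b))) ⟩
    ∑[ b < p ] ((square (Ẑ a b) + square (Ẑ a b)) + (square (E a b) + square (E a b)))
      ≡⟨ trans (∑-distrib-+ p _ _) (cong₂ _+_ (∑-distrib-+ p _ _) (∑-distrib-+ p _ _)) ⟩
    (∑Ẑ² + ∑Ẑ²) + (∑E² + ∑E²)
      ≤⟨ ℚ.+-mono-≤ (ℚ.+-mono-≤ (∑Ẑ²≤ a<p) (∑Ẑ²≤ a<p)) (ℚ.+-mono-≤ (∑E²≤ a<p) (∑E²≤ a<p)) ⟩
    (P * (P * M a) + P * (P * M a)) + (P * P * M a + P * P * M a)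
      ≡⟨ solve 2 (λ P m → (P :* (P :* m) :+ P :* (P :* m)) :+ (P :* P :* m :+ P :* P :* m)
                         := ((P :* P :+ P :* P) :+ (P :* P :+ P :* P)) :* m) refl P (M a) ⟩
    Q * M a ∎
    where
    open ℚ.≤-Reasoning
    open +-*-Solver
    ∑Ẑ² = ∑[ b < p ] square (Ẑ a b)
    ∑E² = ∑[ b < p ] square (E a b)

  N : ℚ
  N = normSq p x

  N≡∑∑ : N ≡ ∑[ b < p ] ∑[ a < b ] square (x (a , b))
  N≡∑∑ = sum-pairs p (λ Q → x Q * x Q)

  ∑M≡2N : ∑[ a < p ] M a ≡ N + N
  ∑M≡2N = trans (∑∑-symmetric p (λ a c → square (X a c)) (λ a c → cong square (X-sym a c))
                   (λ a → trans (cong square (X-diagonal a)) (ℚ.*-zeroˡ 0ℚ)))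
                (cong₂ _+_ lower-triangle lower-triangle)
    where
    lower-triangle : ∑[ c < p ] ∑[ a < c ] square (X a c) ≡ N
    lower-triangle = trans (∑-cong p (λ c _ → ∑-cong c (λ a a<c → cong square (X-< a<c)))) (sym N≡∑∑)

  N≥0 : 0ℚ ≤ N
  N≥0 = ℚ.≤-trans (∑-nonNeg p (λ b _ → ∑-nonNeg b (λ a _ → square-nonNeg (x (a , b))))) (ℚ.≤-reflexive (sym N≡∑∑))

  ∑∑Z²≤ : ∑[ a < p ] ∑[ b < p ] square (Z a b) ≤ Q * (N + N)
  ∑∑Z²≤ = begin
    ∑[ a < p ] ∑[ b < p ] square (Z a b) ≤⟨ ∑-mono-≤ p (λ a a<p → ∑Z²≤ a<p) ⟩
    ∑[ a < p ] (Q * M a)                 ≡⟨ *-distribˡ-∑ p Q M ⟨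
    Q * ∑[ a < p ] M a                   ≡⟨ cong (Q *_) ∑M≡2N ⟩
    Q * (N + N)                          ∎
    where open ℚ.≤-Reasoning

  normSqU≤ : normSqU p x ≤ Q * (N + N) + Q * (N + N) + (Q * (N + N) + Q * (N + N))
  normSqU≤ = begin
    normSqU p x
      ≡⟨ sum-pairs p (λ R → square (sumℚ (map (λ Q → toℚ (U431 p R Q) * x Q) (pairs p)))) ⟩
    ∑[ b < p ] ∑[ a < b ] square (sumℚ (map (λ R → toℚ (U431 p (a , b) R) * x R) (pairs p)))
      ≡⟨ ∑-cong p (λ b b<p → ∑-cong b (λ a a<b → cong square (row-expansion a<b b<p))) ⟩
    ∑[ b < p ] ∑[ a < b ] square (Z a b + Z b a)
      ≤⟨ ∑-mono-≤ p (λ b b<p → ∑-mono-≤-range (ℕ.<⇒≤ b<p) (λ a → square-nonNeg (Z a b + Z b a))) ⟩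
    ∑[ b < p ] ∑[ a < p ] square (Z a b + Z b a)
      ≤⟨ ∑-mono-≤ p (λ b _ → ∑-mono-≤ p (λ a _ → square-sum-≤ (Z a b) (Z b a))) ⟩
    ∑[ b < p ] ∑[ a < p ] ((square (Z a b) + square (Z a b)) + (square (Z b a) + square (Z b a)))
      ≡⟨ trans (∑∑-+ p p _ _) (cong₂ _+_ (∑∑-+ p p _ _) (∑∑-+ p p _ _)) ⟩
    (∑∑ᵀ + ∑∑ᵀ) + (∑∑ + ∑∑)
      ≡⟨ cong (λ w → (w + w) + (∑∑ + ∑∑)) (∑-comm p p (λ b a → square (Z a b))) ⟩
    (∑∑ + ∑∑) + (∑∑ + ∑∑)
      ≤⟨ ℚ.+-mono-≤ (ℚ.+-mono-≤ ∑∑Z²≤ ∑∑Z²≤) (ℚ.+-mono-≤ ∑∑Z²≤ ∑∑Z²≤) ⟩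
    Q * (N + N) + Q * (N + N) + (Q * (N + N) + Q * (N + N)) ∎
    where
    open ℚ.≤-Reasoning
    ∑∑ᵀ = ∑[ b < p ] ∑[ a < p ] square (Z a b)
    ∑∑ = ∑[ a < p ] ∑[ b < p ] square (Z a b)

  norm-bound : normSqU p x ≤ toℚ (+ (6 ℕ.* 6 ℕ.* p ℕ.^ 3)) * N
  norm-bound = begin
    normSqU p x                                              ≤⟨ normSqU≤ ⟩
    Q * (N + N) + Q * (N + N) + (Q * (N + N) + Q * (N + N))  ≡⟨ collect ⟩
    toℚ (+ 32) * (P * P) * N                                 ≡⟨ cong (_* N) (sym (toℚ-32p²)) ⟩
    toℚ (+ (32 ℕ.* (p ℕ.* p))) * N                           ≤⟨ *-monoʳ-≤ N≥0 (toℚ-mono (ℤ.+≤+ 32p²≤36p³)) ⟩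
    toℚ (+ (6 ℕ.* 6 ℕ.* p ℕ.^ 3)) * N                         ∎
    where
    open ℚ.≤-Reasoning
    open +-*-Solver
    collect : Q * (N + N) + Q * (N + N) + (Q * (N + N) + Q * (N + N)) ≡ toℚ (+ 32) * (P * P) * N
    collect = solve 2 (λ P n → let q = (P :* P :+ P :* P) :+ (P :* P :+ P :* P) in
                                 q :* (n :+ n) :+ q :* (n :+ n) :+ (q :* (n :+ n) :+ q :* (n :+ n)) := con (toℚ (+ 32)) :* (P :* P) :* n)
                      refl P N
    toℚ-32p² : toℚ (+ (32 ℕ.* (p ℕ.* p))) ≡ toℚ (+ 32) * (P * P)
    toℚ-32p² = trans (cong toℚ (trans (ℤ.pos-* 32 (p ℕ.* p)) (cong (ℤ._*_ (+ 32)) (ℤ.pos-* p p))))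
                     (trans (toℚ-* (+ 32) (+ p ℤ.* + p)) (cong (toℚ (+ 32) *_) (toℚ-* (+ p) (+ p))))
    32p²≤36p³ : 32 ℕ.* (p ℕ.* p) ℕ.≤ 6 ℕ.* 6 ℕ.* p ℕ.^ 3
    32p²≤36p³ = ℕ.≤-trans (ℕ.*-monoˡ-≤ (p ℕ.* p) (ℕ.m≤m+n 32 4))
                  (ℕ.≤-trans (ℕ.m≤m*n (36 ℕ.* (p ℕ.* p)) p {{p≢0}})
                    (ℕ.≤-reflexive (ℕS.solve 1 (λ p → ℕS.con 36 ℕS.:* (p ℕS.:* p) ℕS.:* p ℕS.:= ℕS.con 6 ℕS.:* ℕS.con 6 ℕS.:* (p ℕS.:^ 3)) refl p)))
      where module ℕS = Data.Nat.Solver.+-*-Solver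

open import Data.Product using (_,_)
open import Relation.Binary.PropositionalEquality using (refl)

p≡1[4]⇒p≢2 : ∀ {p} → p % 4 ≡ 1 → p ≢ 2
p≡1[4]⇒p≢2 () refl

proposition3p28 : ∃ λ (C : ℕ) → ∀ (p : ℕ) (pp : Prime p) → p % 4 ≡ 1 →
    opNormBound p {{prime⇒nonZero pp}} C
proposition3p28 = 6 , λ p prime p≡1[4] → NormBound.norm-bound p prime (p≡1[4]⇒p≢2 p≡1[4])
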